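{- Let $S\subseteq\{0,1\}^n$ be a cube-ideal set-system with connectivity at least $2$, and fix an inequality description of $\mathrm{conv}(S)$ consisting of capacity and GSC inequalities. Let $d$ be the number of connected components of the $2$-cover graph $G(S)$, and let $\kappa$ be the minimum number of variables used in a rainbow inequality belonging to the fixed description ($\kappa=+\infty$ if the fixed description contains no rainbow inequality, in which case $H(1/\kappa)$ is read as $H(0)=0$). Then $|\mathrm{core}(S)|\geq 2^{(1-H(1/\kappa))d}$.
   Context: A set-system is a subset $S\subseteq\{0,1\}^n$; $\mathrm{conv}(S)$ is its convex hull. A capacity inequality is $x_i\geq0$ or $x_i\leq1$. A GSC (generalized set covering) inequality is $\sum_{i\in I}x_i+\sum_{j\in J}(1-x_j)\geq1$ for disjoint $I,J\subseteq[n]$; it uses $|I|+|J|$ variables; a $2$-GSC inequality is one using exactly $2$ variables. $S$ is cube-ideal if $\mathrm{conv}(S)$ is the solution set of some finite family of capacity and GSC inequalities. The connectivity of $S$ is the minimum number of variables in a GSC inequality valid for $\mathrm{conv}(S)$ ($+\infty$ if $S=\{0,1\}^n$). For $S$ of connectivity at least 2, the $2$-cover graph $G(S)$ is the graph on vertex set $[n]$ with an edge $\{i,j\}$ for each pair of distinct indices such that at least one of $x_i+(1-x_j)\geq1$, $(1-x_i)+x_j\geq1$, $x_i+x_j\geq1$, $(1-x_i)+(1-x_j)\geq1$ is valid for $\mathrm{conv}(S)$. $\mathrm{core}(S)$ is the set of points of $S$ satisfying every $2$-GSC inequality valid for $\mathrm{conv}(S)$ with equality. A GSC inequality $\sum_{i\in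 I}x_i+\sum_{j\in J}(1-x_j)\geq1$ valid for $\mathrm{conv}(S)$ is rainbow if $I\cup J$ intersects every connected component of $G(S)$ in at most one element. $H$ is the binary entropy function $H(\varepsilon)=-\varepsilon\log_2\varepsilon-(1-\varepsilon)\log_2(1-\varepsilon)$ for $\varepsilon\in(0,\tfrac12]$, $H(0)=0$. -}

module Defs where

open import Data.Bool using (Bool; true; false)
open import Data.Nat as ℕ using (ℕ; zero; suc; _^_; _∸_)
open import Data.Fin using (Fin; zero; suc)
open import Data.Vec using (Vec; lookup; []; _∷_)
open import Data.List using (List; []; _∷_; map; _++_)
open import Data.List.Relation.Unary.All using (All)
open import Data.List.Relation.Unary.Any using (Any)
open import Data.Product using (Σ; ∃; _×_; _,_)
open import Data.Rational as ℚ using (ℚ; 0ℚ; 1ℚ)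
open import Relation.Binary.PropositionalEquality using (_≡_; _≢_)
open import Relation.Binary.Construct.Closure.ReflexiveTransitive using (Star)
open import Function using (_⇔_)
open import Data.Empty using (⊥)
open import Data.List.Relation.Unary.Unique.Propositional using (Unique)
open import Data.List using (length)
open import Function.Definitions using (Surjective)

Point : ℕ → Set
Point n = Vec Bool n

SetSystem : ℕ → Set
SetSystem n = Point n → Bool

bℚ : Bool → ℚ
bℚ true = 1ℚ
bℚ false = 0ℚ

Σℚ : ∀ {n} → (Fin n → ℚ) → ℚ
Σℚ {zero} f = 0ℚ
Σℚ {suc n} f = f zero ℚ.+ Σℚ (λ i → f (suc i))

countFin : ∀ {n} → (Fin n → Bool) → ℕ
countFin {zero} f = 0
countFin {suc n} f with f zero
... | true = suc (countFin (λ i → f (suc i)))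
... | false = countFin (λ i → f (suc i))

-- A GSC inequality  Σ_{i∈I} x_i + Σ_{j∈J} (1 - x_j) ≥ 1  with I, J disjoint:
-- each index is in I (pos), in J (neg), or in neither (none).
data Sign : Set where
  pos neg none : Sign

GSC : ℕ → Set
GSC n = Fin n → Sign

used : Sign → Bool
used none = false
used _ = true

nvars : ∀ {n} → GSC n → ℕ
nvars g = countFin (λ i → used (g i))

term : Sign → ℚ → ℚ
term pos q = q
term neg q = 1ℚ ℚ.- q
term none q = 0ℚ

lhs : ∀ {n} → GSC n → (Fin n → ℚ) → ℚ
lhs g x = Σℚ (λ i → term (g i) (x i))

SatGSC : ∀ {n} → GSC n → (Fin n → ℚ) → Set
SatGSC g x = 1ℚ ℚ.≤ lhs g x

data Ineq (n : ℕ) : Set where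
  lower : Fin n → Ineq n
  upper : Fin n → Ineq n
  gsc   : GSC n → Ineq n

Sat : ∀ {n} → (Fin n → ℚ) → Ineq n → Set
Sat x (lower i) = 0ℚ ℚ.≤ x i
Sat x (upper i) = x i ℚ.≤ 1ℚ
Sat x (gsc g) = SatGSC g x

Σlist : ∀ {n} → List (ℚ × Point n) → (ℚ × Point n → ℚ) → ℚ
Σlist [] f = 0ℚ
Σlist (p ∷ ps) f = f p ℚ.+ Σlist ps f

coef : ∀ {n} → ℚ × Point n → ℚ
coef (λ₀ , v) = λ₀

InConv : ∀ {n} → SetSystem n → (Fin n → ℚ) → Set
InConv {n} S x = Σ (List (ℚ × Point n)) λ L →
    All (λ { (λ₀ , v) → (0ℚ ℚ.≤ λ₀) × (S v ≡ true) }) L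
  × (Σlist L coef ≡ 1ℚ)
  × (∀ i → x i ≡ Σlist L (λ { (λ₀ , v) → λ₀ ℚ.* bℚ (lookup v i) }))

Describes : ∀ {n} → SetSystem n → List (Ineq n) → Set
Describes S D = ∀ x → (All (Sat x) D ⇔ InConv S x)

CubeIdeal : ∀ {n} → SetSystem n → Set
CubeIdeal {n} S = Σ (List (Ineq n)) (Describes S)

ValidGSC : ∀ {n} → SetSystem n → GSC n → Set
ValidGSC S g = ∀ x → InConv S x → SatGSC g x

Connectivity≥2 : ∀ {n} → SetSystem n → Set
Connectivity≥2 S = ∀ g → ValidGSC S g → 2 ℕ.≤ nvars g

Adj : ∀ {n} → SetSystem n → Fin n → Fin n → Set
Adj S i j = (i ≢ j) × ∃ λ g → ValidGSC S g × (nvars g ≡ 2)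
                                × (used (g i) ≡ true) × (used (g j) ≡ true)

Connected : ∀ {n} → SetSystem n → Fin n → Fin n → Set
Connected S = Star (Adj S)

-- c labels the connected components of G(S) bijectively by Fin d,
-- so that d is the number of connected components.
ComponentLabelling : ∀ {n} → SetSystem n → (d : ℕ) → (Fin n → Fin d) → Set
ComponentLabelling S d c =
  Surjective _≡_ _≡_ c × (∀ i j → (c i ≡ c j) ⇔ Connected S i j)

InCore : ∀ {n} → SetSystem n → Point n → Set
InCore S v = (S v ≡ true)
  × (∀ g → ValidGSC S g → nvars g ≡ 2 → lhs g (λ i → bℚ (lookup v i)) ≡ 1ℚ)

Rainbow : ∀ {n} → SetSystem n → GSC n → Set
Rainbow S g = ValidGSC S g
  × (∀ i j → used (g i) ≡ true → used (g j) ≡ true → Connected S i j → i ≡ j)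

RainbowIn : ∀ {n} → SetSystem n → List (Ineq n) → GSC n → Set
RainbowIn S D g = Any (_≡ gsc g) D × Rainbow S g

IsKappa : ∀ {n} → SetSystem n → List (Ineq n) → ℕ → Set
IsKappa S D κ = (∃ λ g → RainbowIn S D g × nvars g ≡ κ)
              × (∀ g → RainbowIn S D g → κ ℕ.≤ nvars g)

-- D contains no rainbow inequality (κ = +∞)
NoRainbow : ∀ {n} → SetSystem n → List (Ineq n) → Set
NoRainbow S D = ∀ g → RainbowIn S D g → ⊥

CoreAtLeast : ∀ {n} → SetSystem n → (ℕ → Set) → Set
CoreAtLeast {n} S P = Σ (List (Point n)) λ L →
  Unique L × All (InCore S) L × P (length L)

-- m ≥ 2^{(1 - H(1/κ)) d}, for κ ≥ 2, in the equivalent exact integer form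
--   m^κ · κ^{dκ} ≥ 2^{dκ} · (κ-1)^{d(κ-1)}.
EntropyBound : ℕ → ℕ → ℕ → Set
EntropyBound κ d m =
  2 ^ (d ℕ.* κ) ℕ.* (κ ∸ 1) ^ (d ℕ.* (κ ∸ 1)) ℕ.≤ m ^ κ ℕ.* κ ^ (d ℕ.* κ)

{-# OPTIONS --safe #-}
module Submission where

-- The centre ½·𝟙 satisfies every inequality of the description (each GSC inequality in it uses at
-- least two variables) and makes every valid 2-GSC inequality tight, so every point of S with
-- positive weight in a convex representation of it is a core point; fix one, z. A tight 2-GSC
-- inequality on an edge ij of G(S) fixes x_i ⊕ x_j at core points, so the offset z ⊕ p of a core
-- point p is constant on each component. For v ∈ {0,1}^d let q be the point ε-close to the vertex
-- z ⊕ v∘c, with ε = 1/κ (ε = 0 without rainbow inequalities). Capacity and rainbow inequalities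
-- hold at q, and so do GSC inequalities meeting a component twice with complementary literals at z.
-- Those with equal literals at z are never tight at points of conv(core S) off the facets of the
-- cube, so a line search from the centre shows q ∈ conv(S). Averaging the Hamming distance to
-- z ⊕ v∘c over a convex representation of q then yields a core point whose component offsets are
-- within distance d/κ of v. Hence Hamming balls of radius d/κ around the offsets of core points
-- cover {0,1}^d, and the ball volume 2^(H(1/κ)d) gives the bound.

open import Defs
open import Data.Nat using (ℕ; _≤_; _^_)
open import Data.Fin using (Fin)
open import Data.List using (List)
open import Data.Product using (_×_)

open import Data.Bool using (Bool; true; false; not; _xor_)
open import Data.Bool.Properties as Bool using (not-distribˡ-xor; not-involutive; ¬-not)
open import Data.Empty using (⊥; ⊥-elim)
open import Data.Fin using (zero; suc)
open import Data.Fin.Properties using (suc-injective; any?; _≟_)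
open import Data.List using ([]; _∷_; _++_; length; map; filter; cartesianProductWith; deduplicate)
open import Data.List.Membership.Propositional using (_∈_; find; lose)
import Data.List.Membership.Propositional.Properties as ∈
open import Data.List.Relation.Unary.All as All using (All; []; _∷_)
open import Data.List.Relation.Unary.Any as Any using (Any; here; there)
open import Data.List.Relation.Unary.Unique.Propositional using (Unique)
open import Data.List.Relation.Unary.Unique.DecPropositional.Properties using (deduplicate-!)
import Data.Nat as ℕ
open import Data.Nat using (zero; suc; z≤n; s≤s)
import Data.Nat.Properties as ℕₚ
open import Data.Product using (∃; ∃₂; _,_; proj₁; proj₂)
open import Data.Sum using (_⊎_; inj₁; inj₂)
open import Data.Vec using (Vec; []; _∷_; lookup; zipWith; tabulate; replicate)
open import Data.Vec.Properties as Vec using (lookup-zipWith; lookup∘tabulate)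
open import Data.Vec.Functional using (updateAt)
open import Data.Vec.Functional.Properties using (updateAt-updates; updateAt-minimal)
open import Function using (_∘_; Equivalence; case_of_)
open import Relation.Binary.Bundles using (DecTotalOrder)
import Relation.Binary.Construct.Closure.ReflexiveTransitive as Star
open import Relation.Binary.PropositionalEquality
open import Relation.Nullary using (¬_; ¬?; Dec; yes; no)
open import Relation.Nullary.Decidable using (_×-dec_; toWitness)

module HammingCube where

  open import Data.Nat using (_+_; _*_; _∸_; _/_; _≤?_; NonZero)
  open import Data.Nat.Properties
  open import Data.Nat.DivMod using (m*n/n≡m; /-monoˡ-≤; m/n*n≤m)
  open import Data.List.Properties using (length-++; length-map)
  import Data.List.Relation.Unary.All.Properties as All
  open import Data.List.Relation.Unary.AllPairs using ([]; _∷_)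
  import Data.List.Relation.Unary.Unique.Propositional.Properties as Unique
  open import Data.Nat.Tactic.RingSolver using (solve-∀)

  weight : ∀ {d} → Vec Bool d → ℕ
  weight []          = 0
  weight (true ∷ w)  = suc (weight w)
  weight (false ∷ w) = weight w

  weight≤length : ∀ {d} (w : Vec Bool d) → weight w ≤ d
  weight≤length []          = z≤n
  weight≤length (true ∷ w)  = s≤s (weight≤length w)
  weight≤length (false ∷ w) = m≤n⇒m≤1+n (weight≤length w)

  weight≡0⇒replicate : ∀ {d} (w : Vec Bool d) → weight w ≡ 0 → w ≡ replicate d false
  weight≡0⇒replicate []          _         = refl
  weight≡0⇒replicate (false ∷ w) weight≡0 = cong (false ∷_) (weight≡0⇒replicate w weight≡0)

  bitVectors : ∀ d → List (Vec Bool d)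
  bitVectors zero    = [] ∷ []
  bitVectors (suc d) = map (true ∷_) (bitVectors d) ++ map (false ∷_) (bitVectors d)

  ∈-bitVectors : ∀ {d} (w : Vec Bool d) → w ∈ bitVectors d
  ∈-bitVectors []                = here refl
  ∈-bitVectors         (true ∷ w)  = ∈.∈-++⁺ˡ (∈.∈-map⁺ (true ∷_) (∈-bitVectors w))
  ∈-bitVectors {suc d} (false ∷ w) =
    ∈.∈-++⁺ʳ (map (true ∷_) (bitVectors d)) (∈.∈-map⁺ (false ∷_) (∈-bitVectors w))

  bitVectors-unique : ∀ d → Unique (bitVectors d)
  bitVectors-unique zero    = [] ∷ []
  bitVectors-unique (suc d) =
    Unique.++⁺ (Unique.map⁺ ∷-injectiveʳ (bitVectors-unique d))
               (Unique.map⁺ ∷-injectiveʳ (bitVectors-unique d)) disjoint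
    where
    ∷-injectiveʳ : ∀ {b} {v w : Vec Bool d} → b ∷ v ≡ b ∷ w → v ≡ w
    ∷-injectiveʳ refl = refl
    disjoint : ∀ {w} → ¬ (w ∈ map (true ∷_) (bitVectors d) × w ∈ map (false ∷_) (bitVectors d))
    disjoint (w∈ , w∈′) with ∈.∈-map⁻ (true ∷_) w∈ | ∈.∈-map⁻ (false ∷_) w∈′
    ... | _ , _ , refl | _ , _ , ()

  length-bitVectors : ∀ d → length (bitVectors d) ≡ 2 ^ d
  length-bitVectors zero    = refl
  length-bitVectors (suc d) = begin
    length (map (true ∷_) V ++ map (false ∷_) V)        ≡⟨ length-++ (map (true ∷_) V) ⟩
    length (map (true ∷_) V) + length (map (false ∷_) V) ≡⟨ cong₂ _+_ (length-map _ V) (length-map _ V) ⟩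
    length V + length V                                 ≡⟨ cong (λ m → m + m) (length-bitVectors d) ⟩
    2 ^ d + 2 ^ d                                       ≡⟨ cong (2 ^ d +_) (sym (+-identityʳ (2 ^ d))) ⟩
    2 ^ suc d                                           ∎
    where open ≡-Reasoning
          V = bitVectors d

  module _ {A : Set} where

    private
      remove : ∀ {x : A} {ys} → x ∈ ys → List A
      remove {ys = _ ∷ ys} (here _)    = ys
      remove {ys = y ∷ _}  (there x∈) = y ∷ remove x∈

      length-remove : ∀ {x : A} {ys} (x∈ : x ∈ ys) → length ys ≡ suc (length (remove x∈))
      length-remove (here _)    = refl
      length-remove (there x∈) = cong suc (length-remove x∈)

      ∈-remove : ∀ {x y : A} {ys} (x∈ : x ∈ ys) → y ∈ ys → y ≢ x → y ∈ remove x∈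
      ∈-remove (here refl) (here refl) y≢x = ⊥-elim (y≢x refl)
      ∈-remove (here _)    (there y∈)  _   = y∈
      ∈-remove (there _)   (here y≡)   _   = here y≡
      ∈-remove (there x∈) (there y∈)  y≢x = there (∈-remove x∈ y∈ y≢x)

    unique⊆⇒length≤ : ∀ {xs ys : List A} → Unique xs → (∀ {x} → x ∈ xs → x ∈ ys) →
                       length xs ≤ length ys
    unique⊆⇒length≤ {[]}     _            _  = z≤n
    unique⊆⇒length≤ {x ∷ xs} (x∉xs ∷ uxs) xs⊆ys rewrite length-remove (xs⊆ys (here refl)) =
      s≤s (unique⊆⇒length≤ uxs λ y∈xs →
        ∈-remove _ (xs⊆ys (there y∈xs)) λ y≡x → All.lookup x∉xs y∈xs (sym y≡x))

  length-cartesianProductWith : ∀ {A B C : Set} (f : A → B → C) xs ys →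
    length (cartesianProductWith f xs ys) ≡ length xs * length ys
  length-cartesianProductWith f []       ys = refl
  length-cartesianProductWith f (x ∷ xs) ys = begin
    length (map (f x) ys ++ cartesianProductWith f xs ys)        ≡⟨ length-++ (map (f x) ys) ⟩
    length (map (f x) ys) + length (cartesianProductWith f xs ys) ≡⟨ cong₂ _+_ (length-map (f x) ys)
                                                                      (length-cartesianProductWith f xs ys) ⟩
    length ys + length xs * length ys                           ∎
    where open ≡-Reasoning

  covering-bound : ∀ {A : Set} {d} (_⊕_ : A → Vec Bool d → Vec Bool d) (P : List A)
    (W : List (Vec Bool d)) → (∀ v → ∃₂ λ p w → p ∈ P × w ∈ W × v ≡ p ⊕ w) →
    2 ^ d ≤ length P * length W
  covering-bound {d = d} _⊕_ P W covers =
    subst₂ _≤_ (length-bitVectors d) (length-cartesianProductWith _⊕_ P W)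
      (unique⊆⇒length≤ (bitVectors-unique d) λ {v} _ → sum∈ (covers v))
    where
    sum∈ : ∀ {v} → (∃₂ λ p w → p ∈ P × w ∈ W × v ≡ p ⊕ w) → v ∈ cartesianProductWith _⊕_ P W
    sum∈ (p , w , p∈ , w∈ , refl) = AnyP.cartesianProductWith⁺ _⊕_ (λ { refl refl → refl }) p∈ w∈
      where import Data.List.Relation.Unary.Any.Properties as AnyP

  ∑ : ∀ {A : Set} → List A → (A → ℕ) → ℕ
  ∑ []       f = 0
  ∑ (x ∷ xs) f = f x + ∑ xs f

  module _ {A : Set} where

    ∑-++ : ∀ (xs ys : List A) f → ∑ (xs ++ ys) f ≡ ∑ xs f + ∑ ys f
    ∑-++ []       ys f = refl
    ∑-++ (x ∷ xs) ys f = trans (cong (f x +_) (∑-++ xs ys f)) (sym (+-assoc (f x) _ _))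

    ∑-cong : ∀ (xs : List A) {f g} → (∀ x → f x ≡ g x) → ∑ xs f ≡ ∑ xs g
    ∑-cong []       f≗g = refl
    ∑-cong (x ∷ xs) f≗g = cong₂ _+_ (f≗g x) (∑-cong xs f≗g)

    ∑-map : ∀ {B : Set} (g : B → A) xs f → ∑ (map g xs) f ≡ ∑ xs (f ∘ g)
    ∑-map g []       f = refl
    ∑-map g (x ∷ xs) f = cong (f (g x) +_) (∑-map g xs f)

    *-distribˡ-∑ : ∀ b (xs : List A) f → ∑ xs (λ x → b * f x) ≡ b * ∑ xs f
    *-distribˡ-∑ b []       f = sym (*-zeroʳ b)
    *-distribˡ-∑ b (x ∷ xs) f =
      trans (cong (b * f x +_) (*-distribˡ-∑ b xs f)) (sym (*-distribˡ-+ b (f x) _))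

    ∑-filter≤∑ : ∀ {P : A → Set} (P? : ∀ x → Dec (P x)) xs f → ∑ (filter P? xs) f ≤ ∑ xs f
    ∑-filter≤∑ P? []       f = z≤n
    ∑-filter≤∑ P? (x ∷ xs) f with P? x
    ... | yes _ = +-monoʳ-≤ (f x) (∑-filter≤∑ P? xs f)
    ... | no  _ = ≤-trans (∑-filter≤∑ P? xs f) (m≤n+m _ (f x))

    length*≤∑ : ∀ {a} (xs : List A) f → All (λ x → a ≤ f x) xs → length xs * a ≤ ∑ xs f
    length*≤∑ []       f []           = z≤n
    length*≤∑ (x ∷ xs) f (a≤fx ∷ a≤f) = +-mono-≤ a≤fx (length*≤∑ xs f a≤f)

  ∑-binomial : ∀ b d → ∑ (bitVectors d) (λ w → b ^ (d ∸ weight w)) ≡ suc b ^ d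
  ∑-binomial b zero    = refl
  ∑-binomial b (suc d) = begin
    ∑ (map (true ∷_) V ++ map (false ∷_) V) f          ≡⟨ ∑-++ (map (true ∷_) V) _ f ⟩
    ∑ (map (true ∷_) V) f + ∑ (map (false ∷_) V) f     ≡⟨ cong₂ _+_ (∑-map _ V f) (∑-map _ V f) ⟩
    ∑ V g + ∑ V (λ w → b ^ (suc d ∸ weight w))         ≡⟨ cong (∑ V g +_) (∑-cong V λ w →
                                                            cong (b ^_) (+-∸-assoc 1 (weight≤length w))) ⟩
    ∑ V g + ∑ V (λ w → b * g w)                        ≡⟨ cong (∑ V g +_) (*-distribˡ-∑ b V g) ⟩
    ∑ V g + b * ∑ V g                                  ≡⟨ cong (λ s → s + b * s) (∑-binomial b d) ⟩
    suc b ^ suc d                                      ∎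
    where
    open ≡-Reasoning
    V = bitVectors d
    f : Vec Bool (suc d) → ℕ
    f w = b ^ (suc d ∸ weight w)
    g : Vec Bool d → ℕ
    g w = b ^ (d ∸ weight w)

  hammingBall : ℕ → ∀ d → List (Vec Bool d)
  hammingBall κ d = filter (λ w → κ * weight w ≤? d) (bitVectors d)

  ∈-hammingBall : ∀ κ {d} (w : Vec Bool d) → κ * weight w ≤ d → w ∈ hammingBall κ d
  ∈-hammingBall κ {d} w = ∈.∈-filter⁺ (λ w → κ * weight w ≤? d) (∈-bitVectors w)

  ^-distribʳ-* : ∀ a b k → (a * b) ^ k ≡ a ^ k * b ^ k
  ^-distribʳ-* a b zero    = refl
  ^-distribʳ-* a b (suc k) = trans (cong (a * b *_) (^-distribʳ-* a b k)) (lemma a b (a ^ k) (b ^ k))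
    where lemma : ∀ a b x y → a * b * (x * y) ≡ a * x * (b * y)
          lemma = solve-∀

  -- Every w in the ball has b^(d - weight w) ≥ b^(d - ⌊d/κ⌋), and these terms sum to at most κ^d.
  hammingBall-bound : ∀ b d .{{_ : NonZero b}} →
    length (hammingBall (suc b) d) ^ suc b * b ^ (d * b) ≤ suc b ^ (d * suc b)
  hammingBall-bound b d = begin
    B ^ κ * b ^ (d * b)   ≤⟨ *-monoʳ-≤ (B ^ κ) (^-monoʳ-≤ b exponent≤) ⟩
    B ^ κ * b ^ (r * κ)   ≡⟨ cong (B ^ κ *_) (sym (^-*-assoc b r κ)) ⟩
    B ^ κ * (b ^ r) ^ κ   ≡⟨ sym (^-distribʳ-* B (b ^ r) κ) ⟩
    (B * b ^ r) ^ κ       ≤⟨ ^-monoˡ-≤ κ (≤-trans ball≤ (≤-trans (∑-filter≤∑ _ (bitVectors d) f)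
                                                               (≤-reflexive (∑-binomial b d)))) ⟩
    (κ ^ d) ^ κ           ≡⟨ ^-*-assoc κ d κ ⟩
    κ ^ (d * κ)           ∎
    where
    open ≤-Reasoning
    κ = suc b
    B = length (hammingBall κ d)
    r = d ∸ d / κ
    f : Vec Bool d → ℕ
    f w = b ^ (d ∸ weight w)
    term≥ : ∀ w → κ * weight w ≤ d → b ^ r ≤ f w
    term≥ w κw≤d = ^-monoʳ-≤ b (∸-monoʳ-≤ d (subst (_≤ d / κ) (m*n/n≡m (weight w) κ)
                                   (/-monoˡ-≤ κ (subst (_≤ d) (*-comm κ (weight w)) κw≤d))))
    ball≤ : B * b ^ r ≤ ∑ (hammingBall κ d) f
    ball≤ = length*≤∑ (hammingBall κ d) f
              (All.map (λ {w} → term≥ w) (All.all-filter (λ w → κ * weight w ≤? d) (bitVectors d)))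
    exponent≤ : d * b ≤ r * κ
    exponent≤ = begin
      d * b                  ≡⟨ *-distribˡ-∸ d κ 1 ⟩
      d * κ ∸ d * 1          ≡⟨ cong (d * κ ∸_) (*-identityʳ d) ⟩
      d * κ ∸ d              ≤⟨ ∸-monoʳ-≤ (d * κ) (m/n*n≤m d κ) ⟩
      d * κ ∸ (d / κ) * κ    ≡⟨ sym (*-distribʳ-∸ κ d (d / κ)) ⟩
      r * κ                  ∎

  entropyBound-of-covering : ∀ κ d m B → 2 ^ d ≤ m * B →
    B ^ κ * (κ ∸ 1) ^ (d * (κ ∸ 1)) ≤ κ ^ (d * κ) →
    EntropyBound κ d m
  entropyBound-of-covering κ d m B cover ball = begin
    2 ^ (d * κ) * K      ≡⟨ cong (_* K) (sym (^-*-assoc 2 d κ)) ⟩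
    (2 ^ d) ^ κ * K      ≤⟨ *-monoˡ-≤ K (^-monoˡ-≤ κ cover) ⟩
    (m * B) ^ κ * K      ≡⟨ cong (_* K) (^-distribʳ-* m B κ) ⟩
    m ^ κ * B ^ κ * K    ≡⟨ *-assoc (m ^ κ) (B ^ κ) K ⟩
    m ^ κ * (B ^ κ * K)  ≤⟨ *-monoʳ-≤ (m ^ κ) ball ⟩
    m ^ κ * κ ^ (d * κ)  ∎
    where
    open ≤-Reasoning
    K = (κ ∸ 1) ^ (d * (κ ∸ 1))

open HammingCube
  using (weight; weight≡0⇒replicate; bitVectors; ∈-bitVectors; covering-bound;
         hammingBall; ∈-hammingBall; hammingBall-bound; entropyBound-of-covering)

import Data.Rational as ℚ
open import Data.Rational using (ℚ; 0ℚ; 1ℚ; ½; _+_; _*_; _-_; -_; 1/_)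
import Data.Rational.Properties as ℚₚ
open import Data.Rational.Solver using (module +-*-Solver)
open +-*-Solver using (solve; _:=_; _:+_; _:*_; _:-_; :-_; con)
open import Algebra.Bundles using (CommutativeRing)
open import Algebra.Properties.Semiring.Mult (CommutativeRing.semiring ℚₚ.+-*-commutativeRing)
  using (×-homo-+; ×-assoc-*; ×-comm-*; ×1-homo-*) renaming (_×_ to _·_)

private
  a+[b-a]≡b : ∀ a b → a + (b - a) ≡ b
  a+[b-a]≡b = solve 2 (λ a b → a :+ (b :- a) := b) refl

≤⇒0≤- : ∀ {a b} → a ℚ.≤ b → 0ℚ ℚ.≤ b - a
≤⇒0≤- {a} {b} a≤b = subst (ℚ._≤ b - a) (ℚₚ.+-inverseʳ a) (ℚₚ.+-monoˡ-≤ (- a) a≤b)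

<⇒0<- : ∀ {a b} → a ℚ.< b → 0ℚ ℚ.< b - a
<⇒0<- {a} {b} a<b = subst (ℚ._< b - a) (ℚₚ.+-inverseʳ a) (ℚₚ.+-monoˡ-< (- a) a<b)

0≤-⇒≤ : ∀ {a b} → 0ℚ ℚ.≤ b - a → a ℚ.≤ b
0≤-⇒≤ {a} {b} 0≤b-a = subst₂ ℚ._≤_ (ℚₚ.+-identityʳ a) (a+[b-a]≡b a b) (ℚₚ.+-monoʳ-≤ a 0≤b-a)

0<-⇒< : ∀ {a b} → 0ℚ ℚ.< b - a → a ℚ.< b
0<-⇒< {a} {b} 0<b-a = ℚₚ.≤-<-trans (ℚₚ.≤-reflexive (sym (ℚₚ.+-identityʳ a)))
  (ℚₚ.<-≤-trans (ℚₚ.+-monoʳ-< a 0<b-a) (ℚₚ.≤-reflexive (a+[b-a]≡b a b)))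

≤∧≢⇒< : ∀ {a b} → a ℚ.≤ b → a ≢ b → a ℚ.< b
≤∧≢⇒< {a} {b} a≤b a≢b with a ℚₚ.<? b
... | yes a<b = a<b
... | no  a≮b = ⊥-elim (a≢b (ℚₚ.≤-antisym a≤b (ℚₚ.≮⇒≥ a≮b)))

-≡0⇒≡ : ∀ {a b} → a - b ≡ 0ℚ → a ≡ b
-≡0⇒≡ {a} {b} a-b≡0 = trans (a≡[a-b]+b a b) (trans (cong (_+ b) a-b≡0) (ℚₚ.+-identityˡ b))
  where a≡[a-b]+b : ∀ a b → a ≡ (a - b) + b
        a≡[a-b]+b = solve 2 (λ a b → a := (a :- b) :+ b) refl

*-nonNeg : ∀ {a b} → 0ℚ ℚ.≤ a → 0ℚ ℚ.≤ b → 0ℚ ℚ.≤ a * b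
*-nonNeg {a} {b} 0≤a 0≤b =
  ℚₚ.nonNegative⁻¹ _ {{ℚₚ.nonNeg*nonNeg⇒nonNeg a {{ℚ.nonNegative 0≤a}} b {{ℚ.nonNegative 0≤b}}}}

*-pos : ∀ {a b} → 0ℚ ℚ.< a → 0ℚ ℚ.< b → 0ℚ ℚ.< a * b
*-pos {a} {b} 0<a 0<b = ℚₚ.positive⁻¹ _ {{ℚₚ.pos*pos⇒pos a {{ℚ.positive 0<a}} b {{ℚ.positive 0<b}}}}

+-nonNeg : ∀ {a b} → 0ℚ ℚ.≤ a → 0ℚ ℚ.≤ b → 0ℚ ℚ.≤ a + b
+-nonNeg = ℚₚ.+-mono-≤

weighted-nonNeg : ∀ {c h} → 0ℚ ℚ.≤ c → (0ℚ ℚ.< c → 0ℚ ℚ.≤ h) → 0ℚ ℚ.≤ c * h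
weighted-nonNeg {c} {h} 0≤c h≥0 with 0ℚ ℚₚ.<? c
... | yes 0<c = *-nonNeg 0≤c (h≥0 0<c)
... | no  0≮c = ℚₚ.≤-reflexive (sym (trans (cong (_* h) c≡0) (ℚₚ.*-zeroˡ h)))
  where c≡0 = ℚₚ.≤-antisym (ℚₚ.≮⇒≥ 0≮c) 0≤c

interp : ℚ → ℚ → ℚ → ℚ
interp t a b = (1ℚ - t) * a + t * b

interp-const : ∀ t a → interp t a a ≡ a
interp-const = solve 2 (λ t a → (con 1ℚ :- t) :* a :+ t :* a := a) refl

interp-1 : ∀ a b → interp 1ℚ a b ≡ b
interp-1 = solve 2 (λ a b → (con 1ℚ :- con 1ℚ) :* a :+ con 1ℚ :* b := b) refl

interp-pos : ∀ {t a b} → 0ℚ ℚ.≤ t → t ℚ.< 1ℚ → 0ℚ ℚ.< a → 0ℚ ℚ.≤ b → 0ℚ ℚ.< interp t a b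
interp-pos {t} {a} 0≤t t<1 0<a 0≤b =
  ℚₚ.<-≤-trans (subst (0ℚ ℚ.<_) (sym (ℚₚ.+-identityʳ _)) (*-pos (<⇒0<- t<1) 0<a))
               (ℚₚ.+-monoʳ-≤ ((1ℚ - t) * a) (*-nonNeg 0≤t 0≤b))

interp-nonNeg : ∀ {t a b} → 0ℚ ℚ.≤ t → t ℚ.≤ 1ℚ → 0ℚ ℚ.≤ a → 0ℚ ℚ.≤ b → 0ℚ ℚ.≤ interp t a b
interp-nonNeg 0≤t t≤1 0≤a 0≤b = +-nonNeg (*-nonNeg (≤⇒0≤- t≤1) 0≤a) (*-nonNeg 0≤t 0≤b)

Σℚ-cong : ∀ {m} {f g : Fin m → ℚ} → (∀ k → f k ≡ g k) → Σℚ f ≡ Σℚ g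
Σℚ-cong {zero}  f≗g = refl
Σℚ-cong {suc m} f≗g = cong₂ _+_ (f≗g zero) (Σℚ-cong (f≗g ∘ suc))

Σℚ-0 : ∀ {m} {f : Fin m → ℚ} → (∀ k → f k ≡ 0ℚ) → Σℚ f ≡ 0ℚ
Σℚ-0 {zero}  f≗0 = refl
Σℚ-0 {suc m} f≗0 = trans (cong₂ _+_ (f≗0 zero) (Σℚ-0 (f≗0 ∘ suc))) (ℚₚ.+-identityˡ 0ℚ)

Σℚ-* : ∀ {m} c (f : Fin m → ℚ) → Σℚ (λ k → c * f k) ≡ c * Σℚ f
Σℚ-* {zero}  c f = sym (ℚₚ.*-zeroʳ c)
Σℚ-* {suc m} c f = trans (cong (c * f zero +_) (Σℚ-* c (f ∘ suc))) (sym (ℚₚ.*-distribˡ-+ c (f zero) _))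

Σℚ-nonNeg : ∀ {m} {f : Fin m → ℚ} → (∀ k → 0ℚ ℚ.≤ f k) → 0ℚ ℚ.≤ Σℚ f
Σℚ-nonNeg {zero}  f≥0 = ℚₚ.≤-refl
Σℚ-nonNeg {suc m} f≥0 = +-nonNeg (f≥0 zero) (Σℚ-nonNeg (f≥0 ∘ suc))

Σℚ-interp : ∀ {m} t (f g : Fin m → ℚ) → Σℚ (λ k → interp t (f k) (g k)) ≡ interp t (Σℚ f) (Σℚ g)
Σℚ-interp {zero}  t f g = sym (interp-const t 0ℚ)
Σℚ-interp {suc m} t f g =
  trans (cong (interp t (f zero) (g zero) +_) (Σℚ-interp t (f ∘ suc) (g ∘ suc)))
        (interp-+ t (f zero) (g zero) (Σℚ (f ∘ suc)) (Σℚ (g ∘ suc)))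
  where interp-+ : ∀ t a b c d → interp t a b + interp t c d ≡ interp t (a + c) (b + d)
        interp-+ = solve 5 (λ t a b c d → ((con 1ℚ :- t) :* a :+ t :* b) :+ ((con 1ℚ :- t) :* c :+ t :* d)
                                          := (con 1ℚ :- t) :* (a :+ c) :+ t :* (b :+ d)) refl

Σℚ-single : ∀ {m} (f : Fin m → ℚ) i → (∀ k → k ≢ i → f k ≡ 0ℚ) → Σℚ f ≡ f i
Σℚ-single f zero    f≗0 = trans (cong (f zero +_) (Σℚ-0 (λ k → f≗0 (suc k) λ ()))) (ℚₚ.+-identityʳ _)
Σℚ-single f (suc i) f≗0 = trans (cong₂ _+_ (f≗0 zero λ ()) (Σℚ-single (f ∘ suc) i λ k k≢i →
  f≗0 (suc k) (k≢i ∘ suc-injective))) (ℚₚ.+-identityˡ _)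

Σℚ-pair : ∀ {m} (f : Fin m → ℚ) {i j} → i ≢ j → (∀ k → k ≢ i → k ≢ j → f k ≡ 0ℚ) → Σℚ f ≡ f i + f j
Σℚ-pair f {zero}  {zero}  i≢j _   = ⊥-elim (i≢j refl)
Σℚ-pair f {zero}  {suc j} _   f≗0 =
  cong (f zero +_) (Σℚ-single (f ∘ suc) j λ k k≢j → f≗0 (suc k) (λ ()) (k≢j ∘ suc-injective))
Σℚ-pair f {suc i} {zero}  _   f≗0 = trans
  (cong (f zero +_) (Σℚ-single (f ∘ suc) i λ k k≢i → f≗0 (suc k) (k≢i ∘ suc-injective) (λ ())))
  (ℚₚ.+-comm (f zero) (f (suc i)))
Σℚ-pair f {suc i} {suc j} i≢j f≗0 = trans
  (cong₂ _+_ (f≗0 zero (λ ()) (λ ())) (Σℚ-pair (f ∘ suc) (i≢j ∘ cong suc) λ k k≢i k≢j →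
    f≗0 (suc k) (k≢i ∘ suc-injective) (k≢j ∘ suc-injective)))
  (ℚₚ.+-identityˡ _)

Σℚ-≥-single : ∀ {m} (f : Fin m → ℚ) i → (∀ k → 0ℚ ℚ.≤ f k) → f i ℚ.≤ Σℚ f
Σℚ-≥-single f zero    f≥0 =
  subst (ℚ._≤ Σℚ f) (ℚₚ.+-identityʳ (f zero)) (ℚₚ.+-monoʳ-≤ (f zero) (Σℚ-nonNeg (f≥0 ∘ suc)))
Σℚ-≥-single f (suc i) f≥0 = subst (ℚ._≤ Σℚ f) (ℚₚ.+-identityˡ (f (suc i)))
  (ℚₚ.+-mono-≤ (f≥0 zero) (Σℚ-≥-single (f ∘ suc) i (f≥0 ∘ suc)))

Σℚ-≥-pair : ∀ {m} (f : Fin m → ℚ) {i j} → i ≢ j → (∀ k → 0ℚ ℚ.≤ f k) → f i + f j ℚ.≤ Σℚ f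
Σℚ-≥-pair f {zero}  {zero}  i≢j _   = ⊥-elim (i≢j refl)
Σℚ-≥-pair f {zero}  {suc j} _   f≥0 = ℚₚ.+-monoʳ-≤ (f zero) (Σℚ-≥-single (f ∘ suc) j (f≥0 ∘ suc))
Σℚ-≥-pair f {suc i} {zero}  _   f≥0 = subst (ℚ._≤ Σℚ f) (ℚₚ.+-comm (f zero) (f (suc i)))
  (ℚₚ.+-monoʳ-≤ (f zero) (Σℚ-≥-single (f ∘ suc) i (f≥0 ∘ suc)))
Σℚ-≥-pair f {suc i} {suc j} i≢j f≥0 = subst (ℚ._≤ Σℚ f) (ℚₚ.+-identityˡ _)
  (ℚₚ.+-mono-≤ (f≥0 zero) (Σℚ-≥-pair (f ∘ suc) (i≢j ∘ cong suc) (f≥0 ∘ suc)))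

×-nonNeg : ∀ m {e} → 0ℚ ℚ.≤ e → 0ℚ ℚ.≤ m · e
×-nonNeg zero    0≤e = ℚₚ.≤-refl
×-nonNeg (suc m) 0≤e = +-nonNeg 0≤e (×-nonNeg m 0≤e)

×-monoˡ-≤ : ∀ {m n e} → 0ℚ ℚ.≤ e → m ≤ n → m · e ℚ.≤ n · e
×-monoˡ-≤ {n = n} 0≤e z≤n       = ×-nonNeg n 0≤e
×-monoˡ-≤ {e = e} 0≤e (s≤s m≤n) = ℚₚ.+-monoʳ-≤ e (×-monoˡ-≤ 0≤e m≤n)

×-zeroʳ : ∀ m → m · 0ℚ ≡ 0ℚ
×-zeroʳ zero    = refl
×-zeroʳ (suc m) = trans (ℚₚ.+-identityˡ (m · 0ℚ)) (×-zeroʳ m)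

×1-pos : ∀ m → 0ℚ ℚ.< suc m · 1ℚ
×1-pos m = ℚₚ.<-≤-trans (ℚₚ.positive⁻¹ 1ℚ) (subst (ℚ._≤ suc m · 1ℚ) (ℚₚ.+-identityʳ 1ℚ)
  (ℚₚ.+-monoʳ-≤ 1ℚ (×-nonNeg m (ℚₚ.nonNegative⁻¹ 1ℚ))))

×1-cancel-≤ : ∀ {m n} → m · 1ℚ ℚ.≤ n · 1ℚ → m ≤ n
×1-cancel-≤ {m} {n} m≤n with m ℕ.≤? n
... | yes m≤n′ = m≤n′
... | no  m≰n  = ⊥-elim (ℚₚ.<-irrefl refl (ℚₚ.<-≤-trans n<m m≤n))
  where
  open ℕₚ using (≰⇒>; m+[n∸m]≡n; +-suc)
  k = m ℕ.∸ suc n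
  m≡n+suc-k : m ≡ n ℕ.+ suc k
  m≡n+suc-k = sym (trans (+-suc n k) (m+[n∸m]≡n (≰⇒> m≰n)))
  n<m : n · 1ℚ ℚ.< m · 1ℚ
  n<m = subst (n · 1ℚ ℚ.<_) (sym (trans (cong (_· 1ℚ) m≡n+suc-k) (×-homo-+ 1ℚ n (suc k))))
          (subst (ℚ._< n · 1ℚ + suc k · 1ℚ) (ℚₚ.+-identityʳ _) (ℚₚ.+-monoʳ-< (n · 1ℚ) (×1-pos k)))

countFin·≤Σℚ : ∀ {m} (u : Fin m → Bool) (f : Fin m → ℚ) {e} → (∀ k → 0ℚ ℚ.≤ f k) →
  (∀ k → u k ≡ true → e ℚ.≤ f k) → countFin u · e ℚ.≤ Σℚ f
countFin·≤Σℚ {zero}  u f f≥0 f≥e = ℚₚ.≤-refl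
countFin·≤Σℚ {suc m} u f f≥0 f≥e with u zero in u₀
... | true  = ℚₚ.+-mono-≤ (f≥e zero u₀) (countFin·≤Σℚ (u ∘ suc) (f ∘ suc) (f≥0 ∘ suc) (f≥e ∘ suc))
... | false = subst (ℚ._≤ Σℚ f) (ℚₚ.+-identityˡ _)
                (ℚₚ.+-mono-≤ (f≥0 zero) (countFin·≤Σℚ (u ∘ suc) (f ∘ suc) (f≥0 ∘ suc) (f≥e ∘ suc)))

module _ {n : ℕ} where

  private
    Combination = List (ℚ × Point n)

  Σlist-cong : ∀ (L : Combination) {f g} → (∀ p → f p ≡ g p) → Σlist L f ≡ Σlist L g
  Σlist-cong []      f≗g = refl
  Σlist-cong (p ∷ L) f≗g = cong₂ _+_ (f≗g p) (Σlist-cong L f≗g)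

  Σlist-+ : ∀ (L : Combination) f g → Σlist L (λ p → f p + g p) ≡ Σlist L f + Σlist L g
  Σlist-+ []      f g = refl
  Σlist-+ (p ∷ L) f g = trans (cong (f p + g p +_) (Σlist-+ L f g)) (+-interchange (f p) (g p) _ _)
    where +-interchange : ∀ a b c d → (a + b) + (c + d) ≡ (a + c) + (b + d)
          +-interchange = solve 4 (λ a b c d → (a :+ b) :+ (c :+ d) := (a :+ c) :+ (b :+ d)) refl

  Σlist-* : ∀ (L : Combination) c f → Σlist L (λ p → c * f p) ≡ c * Σlist L f
  Σlist-* []      c f = sym (ℚₚ.*-zeroʳ c)
  Σlist-* (p ∷ L) c f = trans (cong (c * f p +_) (Σlist-* L c f)) (sym (ℚₚ.*-distribˡ-+ c (f p) _))

  Σlist-0 : ∀ (L : Combination) → Σlist L (λ _ → 0ℚ) ≡ 0ℚ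
  Σlist-0 []      = refl
  Σlist-0 (p ∷ L) = trans (ℚₚ.+-identityˡ _) (Σlist-0 L)

  Σℚ-Σlist : ∀ {m} (L : Combination) (f : Fin m → ℚ × Point n → ℚ) →
    Σℚ (λ k → Σlist L (f k)) ≡ Σlist L (λ p → Σℚ (λ k → f k p))
  Σℚ-Σlist {zero}  L f = sym (Σlist-0 L)
  Σℚ-Σlist {suc m} L f =
    trans (cong (Σlist L (f zero) +_) (Σℚ-Σlist L (f ∘ suc))) (sym (Σlist-+ L (f zero) _))

  average : Combination → (ℚ × Point n → ℚ) → ℚ
  average L f = Σlist L (λ p → coef p * f p)

  Support : ℚ × Point n → Set
  Support p = 0ℚ ℚ.< coef p

  module _ {L : Combination} (total : Σlist L coef ≡ 1ℚ) where

    average-affine : ∀ a b f → average L (λ p → a + b * f p) ≡ a + b * average L f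
    average-affine a b f = begin
      Σlist L (λ p → coef p * (a + b * f p))          ≡⟨ Σlist-cong L (λ p → distrib (coef p) a b (f p)) ⟩
      Σlist L (λ p → a * coef p + b * (coef p * f p)) ≡⟨ Σlist-+ L _ _ ⟩
      Σlist L (λ p → a * coef p) + Σlist L (λ p → b * (coef p * f p))
                                                      ≡⟨ cong₂ _+_ (Σlist-* L a coef) (Σlist-* L b _) ⟩
      a * Σlist L coef + b * average L f              ≡⟨ cong (λ w → a * w + b * average L f) total ⟩
      a * 1ℚ + b * average L f                        ≡⟨ cong (_+ b * average L f) (ℚₚ.*-identityʳ a) ⟩
      a + b * average L f                             ∎
      where
      open ≡-Reasoning
      distrib : ∀ c a b x → c * (a + b * x) ≡ a * c + b * (c * x)
      distrib = solve 4 (λ c a b x → c :* (a :+ b :* x) := a :* c :+ b :* (c :* x)) refl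

    average-minus : ∀ a f → average L (λ p → a - f p) ≡ a - average L f
    average-minus a f = trans (Σlist-cong L λ p → cong (coef p *_) (minus-as-affine a (f p)))
      (trans (average-affine a (- 1ℚ) f) (sym (minus-as-affine a (average L f))))
      where minus-as-affine : ∀ a x → a - x ≡ a + (- 1ℚ) * x
            minus-as-affine = solve 2 (λ a x → a :- x := a :+ (:- con 1ℚ) :* x) refl

    average-sub : ∀ f a → average L (λ p → f p - a) ≡ average L f - a
    average-sub f a = trans (Σlist-cong L λ p → cong (coef p *_) (sub-as-affine (f p) a))
      (trans (average-affine (- a) 1ℚ f) (sym (sub-as-affine (average L f) a)))
      where sub-as-affine : ∀ x a → x - a ≡ (- a) + 1ℚ * x
            sub-as-affine = solve 2 (λ x a → x :- a := (:- a) :+ con 1ℚ :* x) refl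

    term-average : ∀ s f → term s (average L f) ≡ average L (λ p → term s (f p))
    term-average pos  f = refl
    term-average neg  f = sym (average-minus 1ℚ f)
    term-average none f = sym (trans (Σlist-cong L λ p → ℚₚ.*-zeroʳ (coef p)) (Σlist-0 L))

    lhs-average : ∀ {m} (g : GSC m) {y : Fin m → ℚ} (f : ℚ × Point n → Fin m → ℚ) →
      (∀ k → y k ≡ average L (λ p → f p k)) → lhs g y ≡ average L (λ p → lhs g (f p))
    lhs-average g {y} f y≡ = begin
      Σℚ (λ k → term (g k) (y k))
        ≡⟨ Σℚ-cong (λ k → trans (cong (term (g k)) (y≡ k)) (term-average (g k) (λ p → f p k))) ⟩
      Σℚ (λ k → Σlist L (λ p → coef p * term (g k) (f p k)))
        ≡⟨ Σℚ-Σlist L (λ k p → coef p * term (g k) (f p k)) ⟩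
      Σlist L (λ p → Σℚ (λ k → coef p * term (g k) (f p k)))
        ≡⟨ Σlist-cong L (λ p → Σℚ-* (coef p) (λ k → term (g k) (f p k))) ⟩
      average L (λ p → lhs g (f p))
        ∎
      where open ≡-Reasoning

  weighted-sum-nonNeg : ∀ {L : Combination} {h : ℚ × Point n → ℚ} → All (λ p → 0ℚ ℚ.≤ coef p) L →
    All (λ p → Support p → 0ℚ ℚ.≤ h p) L → 0ℚ ℚ.≤ Σlist L (λ p → coef p * h p)
  weighted-sum-nonNeg         []           []           = ℚₚ.≤-refl
  weighted-sum-nonNeg {h = h} (0≤c ∷ 0≤cs) (h≥0 ∷ hs≥0) =
    +-nonNeg (weighted-nonNeg 0≤c h≥0) (weighted-sum-nonNeg {h = h} 0≤cs hs≥0)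

  weighted-sum-pos : ∀ {L : Combination} {h : ℚ × Point n → ℚ} {p} → All (λ p → 0ℚ ℚ.≤ coef p) L →
    All (λ p → Support p → 0ℚ ℚ.≤ h p) L → p ∈ L → Support p → 0ℚ ℚ.< h p →
    0ℚ ℚ.< Σlist L (λ p → coef p * h p)
  weighted-sum-pos {h = h} {p} (_ ∷ 0≤cs) (_ ∷ hs≥0) (here refl) 0<c 0<h =
    ℚₚ.<-≤-trans (subst (0ℚ ℚ.<_) (sym (ℚₚ.+-identityʳ _)) (*-pos 0<c 0<h))
                 (ℚₚ.+-monoʳ-≤ (coef p * h p) (weighted-sum-nonNeg {h = h} 0≤cs hs≥0))
  weighted-sum-pos {L = q ∷ L} {h} (0≤c ∷ 0≤cs) (h≥0 ∷ hs≥0) (there p∈) 0<c 0<h =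
    ℚₚ.<-≤-trans (subst (0ℚ ℚ.<_) (sym (ℚₚ.+-identityˡ _))
                   (weighted-sum-pos {h = h} 0≤cs hs≥0 p∈ 0<c 0<h))
                 (ℚₚ.+-monoˡ-≤ (Σlist L (λ p → coef p * h p)) (weighted-nonNeg 0≤c h≥0))

  module _ {L : Combination} (nonNeg : All (λ p → 0ℚ ℚ.≤ coef p) L) (total : Σlist L coef ≡ 1ℚ) where

    support-nonempty : ∃ λ p → p ∈ L × Support p
    support-nonempty = go nonNeg total
      where
      go : ∀ {L′ : Combination} → All (λ p → 0ℚ ℚ.≤ coef p) L′ → Σlist L′ coef ≡ 1ℚ →
           ∃ λ p → p ∈ L′ × Support p
      go {p ∷ L′} (0≤c ∷ 0≤cs) sum≡1 with 0ℚ ℚₚ.<? coef p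
      ... | yes 0<c = p , here refl , 0<c
      ... | no  0≮c = let q , q∈ , 0<cq = go 0≤cs (trans (sym (ℚₚ.+-identityˡ _))
                                                     (trans (cong (_+ Σlist L′ coef) (sym c≡0)) sum≡1))
                      in q , there q∈ , 0<cq
        where c≡0 = ℚₚ.≤-antisym (ℚₚ.≮⇒≥ 0≮c) 0≤c

    average-≤ : ∀ {f : ℚ × Point n → ℚ} {a} → All (λ p → Support p → f p ℚ.≤ a) L → average L f ℚ.≤ a
    average-≤ {f} {a} f≤a = 0≤-⇒≤ (subst (0ℚ ℚ.≤_) (average-minus {L = L} total a f)
      (weighted-sum-nonNeg {h = λ p → a - f p} nonNeg (All.map (≤⇒0≤- ∘_) f≤a)))

    average-> : ∀ {f : ℚ × Point n → ℚ} {a p} → All (λ p → Support p → a ℚ.≤ f p) L →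
      p ∈ L → Support p → a ℚ.< f p → a ℚ.< average L f
    average-> {f} {a} a≤f p∈ 0<c a<f = 0<-⇒< (subst (0ℚ ℚ.<_) (average-sub {L = L} total f a)
      (weighted-sum-pos {h = λ p → f p - a} nonNeg (All.map (≤⇒0≤- ∘_) a≤f) p∈ 0<c (<⇒0<- a<f)))

    support-≤-average : ∀ {f : ℚ × Point n → ℚ} {a} → average L f ℚ.≤ a →
      ∃ λ p → p ∈ L × Support p × f p ℚ.≤ a
    support-≤-average {f} {a} avg≤a
      with Any.any? (λ p → (0ℚ ℚₚ.<? coef p) ×-dec (f p ℚₚ.≤? a)) L
    ... | yes some = let p , p∈ , sp = find some in p , p∈ , sp
    ... | no  ¬some = ⊥-elim (ℚₚ.<-irrefl refl (ℚₚ.<-≤-trans a<avg avg≤a))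
      where
      above : All (λ p → Support p → a ℚ.< f p) L
      above = All.tabulate λ p∈ 0<c → ℚₚ.≰⇒> λ f≤a → ¬some (lose p∈ (0<c , f≤a))
      p = proj₁ support-nonempty
      p∈ = proj₁ (proj₂ support-nonempty)
      0<c = proj₂ (proj₂ support-nonempty)
      a<avg : a ℚ.< average L f
      a<avg = average-> (All.map (ℚₚ.<⇒≤ ∘_) above) p∈ 0<c (All.lookup above p∈ 0<c)

    support-tight : ∀ {f : ℚ × Point n → ℚ} {a} → All (λ p → a ℚ.≤ f p) L → average L f ℚ.≤ a →
      All (λ p → Support p → f p ≡ a) L
    support-tight {f} {a} a≤f avg≤a = All.tabulate λ {p} p∈ 0<c → tight p∈ 0<c (a ℚₚ.<? f p)
      where
      tight : ∀ {p} → p ∈ L → Support p → Dec (a ℚ.< f p) → f p ≡ a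
      tight p∈ 0<c (yes a<f) = ⊥-elim (ℚₚ.<-irrefl refl
        (ℚₚ.<-≤-trans (average-> (All.map (λ a≤fp _ → a≤fp) a≤f) p∈ 0<c a<f) avg≤a))
      tight p∈ _ (no a≮f) = ℚₚ.≤-antisym (ℚₚ.≮⇒≥ a≮f) (All.lookup a≤f p∈)

-- Generalized set covering inequalities at 0/1 and softened points

xor-cancelˡ : ∀ a b → a xor (a xor b) ≡ b
xor-cancelˡ false b = refl
xor-cancelˡ true  b = not-involutive b

xor-swap : ∀ a b u → a xor (b xor u) ≡ (b xor a) xor u
xor-swap false false u = refl
xor-swap false true  u = refl
xor-swap true  false u = refl
xor-swap true  true  u = not-involutive u

zipWith-xor-cancelˡ : ∀ {d} (y v : Vec Bool d) → zipWith _xor_ y (zipWith _xor_ y v) ≡ v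
zipWith-xor-cancelˡ []      []      = refl
zipWith-xor-cancelˡ (a ∷ y) (b ∷ v) = cong₂ _∷_ (xor-cancelˡ a b) (zipWith-xor-cancelˡ y v)

xor-injectiveˡ : ∀ {a b b′} → a xor b ≡ a xor b′ → b ≡ b′
xor-injectiveˡ {a} {b} {b′} eq = trans (sym (xor-cancelˡ a b)) (trans (cong (a xor_) eq) (xor-cancelˡ a b′))

vertex : ∀ {n} → Point n → Fin n → ℚ
vertex v i = bℚ (lookup v i)

-- The value at none is junk: literals are only consulted at used signs.
literal : Sign → Bool → Bool
literal neg a = not a
literal _   a = a

literal-xor : ∀ s a u → literal s (a xor u) ≡ literal s a xor u
literal-xor pos  a u = refl
literal-xor neg  a u = not-distribˡ-xor a u
literal-xor none a u = refl

term-bℚ : ∀ s a → used s ≡ true → term s (bℚ a) ≡ bℚ (literal s a)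
term-bℚ pos a     _ = refl
term-bℚ neg true  _ = refl
term-bℚ neg false _ = refl

term-bℚ-nonNeg : ∀ s a → 0ℚ ℚ.≤ term s (bℚ a)
term-bℚ-nonNeg pos  true  = ℚₚ.nonNegative⁻¹ 1ℚ
term-bℚ-nonNeg pos  false = ℚₚ.≤-refl
term-bℚ-nonNeg neg  true  = ℚₚ.≤-refl
term-bℚ-nonNeg neg  false = ℚₚ.nonNegative⁻¹ 1ℚ
term-bℚ-nonNeg none a     = ℚₚ.≤-refl

bℚ-complementary : ∀ a b → bℚ a + bℚ b ≡ 1ℚ → a ≡ not b
bℚ-complementary true  false _ = refl
bℚ-complementary false true  _ = refl
bℚ-complementary true  true  ()
bℚ-complementary false false ()

soften : ℚ → Bool → ℚ
soften ε true  = 1ℚ - ε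
soften ε false = ε

term-soften : ∀ ε s a → used s ≡ true → term s (soften ε a) ≡ soften ε (literal s a)
term-soften ε pos a     _ = refl
term-soften ε neg true  _ = 1-[1-ε]≡ε ε
  where 1-[1-ε]≡ε : ∀ ε → 1ℚ - (1ℚ - ε) ≡ ε
        1-[1-ε]≡ε = solve 1 (λ ε → con 1ℚ :- (con 1ℚ :- ε) := ε) refl
term-soften ε neg false _ = refl

soften-complementary : ∀ ε a → soften ε (not a) + soften ε a ≡ 1ℚ
soften-complementary ε false = [1-ε]+ε≡1 ε
  where [1-ε]+ε≡1 : ∀ ε → (1ℚ - ε) + ε ≡ 1ℚ
        [1-ε]+ε≡1 = solve 1 (λ ε → (con 1ℚ :- ε) :+ ε := con 1ℚ) refl
soften-complementary ε true  = ε+[1-ε]≡1 ε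
  where ε+[1-ε]≡1 : ∀ ε → ε + (1ℚ - ε) ≡ 1ℚ
        ε+[1-ε]≡1 = solve 1 (λ ε → ε :+ (con 1ℚ :- ε) := con 1ℚ) refl

term-½ : ∀ s → used s ≡ true → term s ½ ≡ ½
term-½ pos _ = refl
term-½ neg _ = refl

term-½-nonNeg : ∀ s → 0ℚ ℚ.≤ term s ½
term-½-nonNeg pos  = toWitness {a? = 0ℚ ℚₚ.≤? ½} _
term-½-nonNeg neg  = toWitness {a? = 0ℚ ℚₚ.≤? ½} _
term-½-nonNeg none = ℚₚ.≤-refl

-- Summed over coordinates, these terms give the Hamming distance from a vertex to b.
awayFrom : Bool → Sign
awayFrom false = pos
awayFrom true  = neg

term-awayFrom-bℚ : ∀ a b → term (awayFrom b) (bℚ a) ≡ bℚ (a xor b)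
term-awayFrom-bℚ true  false = refl
term-awayFrom-bℚ false false = refl
term-awayFrom-bℚ true  true  = refl
term-awayFrom-bℚ false true  = refl

term-awayFrom-soften : ∀ ε b → term (awayFrom b) (soften ε b) ≡ ε
term-awayFrom-soften ε false = refl
term-awayFrom-soften ε true  = term-soften ε neg true refl

Σℚ-bℚ : ∀ {d} (w : Vec Bool d) → Σℚ (λ C → bℚ (lookup w C)) ≡ weight w · 1ℚ
Σℚ-bℚ []          = refl
Σℚ-bℚ (true ∷ w)  = cong (1ℚ +_) (Σℚ-bℚ w)
Σℚ-bℚ (false ∷ w) = trans (ℚₚ.+-identityˡ _) (Σℚ-bℚ w)

Σℚ-const : ∀ d e → Σℚ {d} (λ _ → e) ≡ d · e
Σℚ-const zero    e = refl
Σℚ-const (suc d) e = cong (e +_) (Σℚ-const d e)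

-- Inequalities using exactly two variables

erase : ∀ {m} → Fin m → (Fin m → Bool) → Fin m → Bool
erase i u = updateAt u i (λ _ → false)

countFin-erase : ∀ {m} (u : Fin m → Bool) i → u i ≡ true → countFin u ≡ suc (countFin (erase i u))
countFin-erase u zero    uᵢ with u zero
countFin-erase u zero    refl | true = refl
countFin-erase u (suc i) uᵢ with u zero
... | true  = cong suc (countFin-erase (u ∘ suc) i uᵢ)
... | false = countFin-erase (u ∘ suc) i uᵢ

countFin≡0 : ∀ {m} (u : Fin m → Bool) → countFin u ≡ 0 → ∀ k → u k ≡ false
countFin≡0 {suc m} u count≡0 k with u zero in u₀
countFin≡0 {suc m} u ()      k       | true
countFin≡0 {suc m} u count≡0 zero    | false = u₀
countFin≡0 {suc m} u count≡0 (suc k) | false = countFin≡0 (u ∘ suc) count≡0 k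

countFin≢0 : ∀ {m} (u : Fin m → Bool) {c} → countFin u ≡ suc c → ∃ λ i → u i ≡ true
countFin≢0 {zero}  u ()
countFin≢0 {suc m} u count≡ with u zero in u₀
... | true  = zero , u₀
... | false = let i , uᵢ = countFin≢0 (u ∘ suc) count≡ in suc i , uᵢ

module _ {n} (h : GSC n) (two : nvars h ≡ 2) where

  two-used : ∃₂ λ i j → i ≢ j × used (h i) ≡ true × used (h j) ≡ true
  two-used with countFin≢0 (used ∘ h) two
  ... | i , uᵢ with countFin≢0 (erase i (used ∘ h)) (ℕₚ.suc-injective (trans (sym (countFin-erase _ i uᵢ)) two))
  ...   | j , u′ⱼ = i , j , j≢i ∘ sym , uᵢ , trans (sym (updateAt-minimal j i (used ∘ h) j≢i)) u′ⱼ
    where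
    j≢i : j ≢ i
    j≢i j≡i = case trans (sym (updateAt-updates i (used ∘ h)))
                         (subst (λ k → erase i (used ∘ h) k ≡ true) j≡i u′ⱼ) of λ ()

  only-two-used : ∀ {i j} → i ≢ j → used (h i) ≡ true → used (h j) ≡ true →
    ∀ k → k ≢ i → k ≢ j → h k ≡ none
  only-two-used {i} {j} i≢j uᵢ uⱼ k k≢i k≢j = unused (h k) (begin
    used (h k)                               ≡⟨ updateAt-minimal k i (used ∘ h) k≢i ⟨
    erase i (used ∘ h) k                     ≡⟨ updateAt-minimal k j (erase i (used ∘ h)) k≢j ⟨
    erase j (erase i (used ∘ h)) k           ≡⟨ countFin≡0 _ count≡0 k ⟩
    false                                    ∎)
    where
    open ≡-Reasoning
    count≡1 : countFin (erase i (used ∘ h)) ≡ 1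
    count≡1 = ℕₚ.suc-injective (trans (sym (countFin-erase (used ∘ h) i uᵢ)) two)
    count≡0 : countFin (erase j (erase i (used ∘ h))) ≡ 0
    count≡0 = ℕₚ.suc-injective (trans (sym (countFin-erase _ j
                (trans (updateAt-minimal j i (used ∘ h) (i≢j ∘ sym)) uⱼ))) count≡1)
    unused : ∀ s → used s ≡ false → s ≡ none
    unused none _ = refl

  lhs-two : ∀ {i j} → i ≢ j → used (h i) ≡ true → used (h j) ≡ true →
    ∀ x → lhs h x ≡ term (h i) (x i) + term (h j) (x j)
  lhs-two i≢j uᵢ uⱼ x = Σℚ-pair (λ k → term (h k) (x k)) i≢j λ k k≢i k≢j →
    cong (λ s → term s (x k)) (only-two-used i≢j uᵢ uⱼ k k≢i k≢j)

equal-literals⇒false : ∀ {n} (g : GSC n) (p : Point n) {i j} → i ≢ j →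
  used (g i) ≡ true → used (g j) ≡ true → literal (g i) (lookup p i) ≡ literal (g j) (lookup p j) →
  lhs g (vertex p) ℚ.≤ 1ℚ → literal (g i) (lookup p i) ≡ false
equal-literals⇒false g p {i} {j} i≢j uᵢ uⱼ equal lhs≤1 with literal (g i) (lookup p i) in litᵢ
... | false = refl
... | true  = ⊥-elim (ℚₚ.<-irrefl refl (ℚₚ.<-≤-trans 1<2 (ℚₚ.≤-trans 2≤lhs lhs≤1)))
  where
  1<2 : 1ℚ ℚ.< 1ℚ + 1ℚ
  1<2 = toWitness {a? = 1ℚ ℚₚ.<? 1ℚ + 1ℚ} _
  2≤lhs : 1ℚ + 1ℚ ℚ.≤ lhs g (vertex p)
  2≤lhs = subst (ℚ._≤ lhs g (vertex p))
    (cong₂ _+_ (trans (term-bℚ (g i) _ uᵢ) (cong bℚ litᵢ))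
               (trans (term-bℚ (g j) _ uⱼ) (cong bℚ (sym equal))))
    (Σℚ-≥-pair (λ k → term (g k) (vertex p k)) i≢j (λ k → term-bℚ-nonNeg (g k) (lookup p k)))

-- Line search along a segment

interp-as-shift : ∀ t a b → interp t a b ≡ a - t * (a - b)
interp-as-shift = solve 3 (λ t a b → (con 1ℚ :- t) :* a :+ t :* b := a :- t :* (a :- b)) refl

-- The root a/(a - b) of t ↦ interp t a b if b < 0 < a - b, and 1 otherwise.
crossing : ℚ → ℚ → ℚ
crossing a b with b ℚₚ.<? 0ℚ | 0ℚ ℚₚ.<? a - b
... | yes _ | yes a-b>0 = a * (1/ (a - b)) {{ℚ.>-nonZero a-b>0}}
... | _     | _         = 1ℚ

private
  a/[a-b]*[a-b]≡a : ∀ a b .{{_ : ℚ.NonZero (a - b)}} → a * 1/ (a - b) * (a - b) ≡ a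
  a/[a-b]*[a-b]≡a a b =
    trans (ℚₚ.*-assoc a _ (a - b)) (trans (cong (a *_) (ℚₚ.*-inverseˡ (a - b))) (ℚₚ.*-identityʳ a))

crossing-nonNeg : ∀ {a} b → 0ℚ ℚ.≤ a → 0ℚ ℚ.≤ crossing a b
crossing-nonNeg {a} b 0≤a with b ℚₚ.<? 0ℚ | 0ℚ ℚₚ.<? a - b
... | yes _ | yes a-b>0 =
  *-nonNeg 0≤a (ℚₚ.<⇒≤ (ℚₚ.positive⁻¹ _ {{ℚₚ.1/pos⇒pos (a - b) {{ℚ.positive a-b>0}}}}))
... | yes _ | no  _     = ℚₚ.nonNegative⁻¹ 1ℚ
... | no  _ | _         = ℚₚ.nonNegative⁻¹ 1ℚ

interp-nonNeg-before-crossing : ∀ {t a} b → 0ℚ ℚ.≤ a → 0ℚ ℚ.≤ t → t ℚ.≤ 1ℚ → t ℚ.≤ crossing a b →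
  0ℚ ℚ.≤ interp t a b
interp-nonNeg-before-crossing {t} {a} b 0≤a 0≤t t≤1 t≤τ with b ℚₚ.<? 0ℚ | 0ℚ ℚₚ.<? a - b
... | yes _   | yes a-b>0 = subst (0ℚ ℚ.≤_) (sym (interp-as-shift t a b)) (≤⇒0≤- (begin
  t * (a - b)                     ≤⟨ ℚₚ.*-monoʳ-≤-nonNeg (a - b) {{ℚ.nonNegative (ℚₚ.<⇒≤ a-b>0)}} t≤τ ⟩
  a * 1/ (a - b) * (a - b)        ≡⟨ a/[a-b]*[a-b]≡a a b ⟩
  a                               ∎))
  where open ℚₚ.≤-Reasoning
        instance _ = ℚ.>-nonZero a-b>0
... | yes b<0 | no  a-b≯0 = ⊥-elim (a-b≯0 (<⇒0<- (ℚₚ.<-≤-trans b<0 0≤a)))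
... | no  b≮0 | _         = interp-nonNeg 0≤t t≤1 0≤a (ℚₚ.≮⇒≥ b≮0)

crossing-root : ∀ a b → crossing a b ≢ 1ℚ → b ℚ.< 0ℚ × interp (crossing a b) a b ≡ 0ℚ
crossing-root a b τ≢1 with b ℚₚ.<? 0ℚ | 0ℚ ℚₚ.<? a - b
... | yes b<0 | yes a-b>0 = b<0 , (begin
  interp τ a b                    ≡⟨ interp-as-shift τ a b ⟩
  a - τ * (a - b)                 ≡⟨ cong (λ s → a - s) (a/[a-b]*[a-b]≡a a b) ⟩
  a - a                           ≡⟨ ℚₚ.+-inverseʳ a ⟩
  0ℚ                              ∎)
  where open ≡-Reasoning
        instance _ = ℚ.>-nonZero a-b>0
        τ = a * 1/ (a - b)
... | yes _   | no  _     = ⊥-elim (τ≢1 refl)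
... | no  _   | _         = ⊥-elim (τ≢1 refl)

-- a x and b x are the values of the affine constraint x at the two ends of the segment.
line-search : ∀ {A : Set} (a b : A → ℚ) (xs : List A) → All (λ x → 0ℚ ℚ.≤ a x) xs →
  ∃ λ t → 0ℚ ℚ.≤ t × t ℚ.≤ 1ℚ × All (λ x → 0ℚ ℚ.≤ interp t (a x) (b x)) xs
        × (t ≡ 1ℚ ⊎ t ℚ.< 1ℚ × Any (λ x → b x ℚ.< 0ℚ × interp t (a x) (b x) ≡ 0ℚ) xs)
line-search a b xs 0≤a =
  t , 0≤t , t≤1 , All.zipWith nonNeg (0≤a , All.map⁻ (min≤xs 1ℚ τs)) , stop (t ℚₚ.≟ 1ℚ)
  where
  open import Data.List.Extrema (DecTotalOrder.totalOrder ℚₚ.≤-decTotalOrder)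
    using (min; min≤⊤; min≤xs; v≤min⁺; argmin-sel)
  import Data.List.Relation.Unary.All.Properties as All
  import Data.List.Membership.Propositional.Properties as ∈
  τ : _ → ℚ
  τ x = crossing (a x) (b x)
  τs = map τ xs
  t = min 1ℚ τs
  0≤t : 0ℚ ℚ.≤ t
  0≤t = v≤min⁺ (ℚₚ.nonNegative⁻¹ 1ℚ) (All.map⁺ (All.map (λ {x} → crossing-nonNeg (b x)) 0≤a))
  t≤1 : t ℚ.≤ 1ℚ
  t≤1 = min≤⊤ 1ℚ τs
  nonNeg : ∀ {x} → 0ℚ ℚ.≤ a x × t ℚ.≤ τ x → 0ℚ ℚ.≤ interp t (a x) (b x)
  nonNeg {x} (0≤ax , t≤τ) = interp-nonNeg-before-crossing (b x) 0≤ax 0≤t t≤1 t≤τ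
  stop : Dec (t ≡ 1ℚ) → t ≡ 1ℚ ⊎ t ℚ.< 1ℚ × Any (λ x → b x ℚ.< 0ℚ × interp t (a x) (b x) ≡ 0ℚ) xs
  stop (yes t≡1) = inj₁ t≡1
  stop (no  t≢1) with argmin-sel (λ s → s) 1ℚ τs
  ... | inj₁ t≡1 = ⊥-elim (t≢1 t≡1)
  ... | inj₂ t∈τs with ∈.∈-map⁻ τ t∈τs
  ...   | x , x∈ , t≡τ = inj₂ (≤∧≢⇒< t≤1 t≢1 , lose x∈
    (subst (λ s → b x ℚ.< 0ℚ × interp s (a x) (b x) ≡ 0ℚ) (sym t≡τ) (crossing-root (a x) (b x) (t≢1 ∘ trans t≡τ))))

segment : ∀ {n} → ℚ → (Fin n → ℚ) → (Fin n → ℚ) → Fin n → ℚ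
segment t x y i = interp t (x i) (y i)

term-interp : ∀ s t a b → term s (interp t a b) ≡ interp t (term s a) (term s b)
term-interp pos  t a b = refl
term-interp neg  t a b = solve 3 (λ t a b → con 1ℚ :- ((con 1ℚ :- t) :* a :+ t :* b)
                                 := (con 1ℚ :- t) :* (con 1ℚ :- a) :+ t :* (con 1ℚ :- b)) refl t a b
term-interp none t a b = sym (interp-const t 0ℚ)

lhs-segment : ∀ {n} (g : GSC n) t x y → lhs g (segment t x y) ≡ interp t (lhs g x) (lhs g y)
lhs-segment g t x y = trans (Σℚ-cong λ k → term-interp (g k) t (x k) (y k))
  (Σℚ-interp t (λ k → term (g k) (x k)) (λ k → term (g k) (y k)))

slack : ∀ {n} → Ineq n → (Fin n → ℚ) → ℚ
slack (lower i) x = x i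
slack (upper i) x = 1ℚ - x i
slack (gsc g)   x = lhs g x - 1ℚ

Sat⇒slack-nonNeg : ∀ {n} (ι : Ineq n) {x} → Sat x ι → 0ℚ ℚ.≤ slack ι x
Sat⇒slack-nonNeg (lower i) sat = sat
Sat⇒slack-nonNeg (upper i) sat = ≤⇒0≤- sat
Sat⇒slack-nonNeg (gsc g)   sat = ≤⇒0≤- sat

slack-nonNeg⇒Sat : ∀ {n} (ι : Ineq n) {x} → 0ℚ ℚ.≤ slack ι x → Sat x ι
slack-nonNeg⇒Sat (lower i) 0≤slack = 0≤slack
slack-nonNeg⇒Sat (upper i) 0≤slack = 0≤-⇒≤ 0≤slack
slack-nonNeg⇒Sat (gsc g)   0≤slack = 0≤-⇒≤ 0≤slack

slack-segment : ∀ {n} (ι : Ineq n) t x y → slack ι (segment t x y) ≡ interp t (slack ι x) (slack ι y)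
slack-segment (lower i) t x y = refl
slack-segment (upper i) t x y = term-interp neg t (x i) (y i)
slack-segment (gsc g)   t x y = trans (cong (_- 1ℚ) (lhs-segment g t x y)) (interp-sub t (lhs g x) (lhs g y))
  where interp-sub : ∀ t a b → interp t a b - 1ℚ ≡ interp t (a - 1ℚ) (b - 1ℚ)
        interp-sub = solve 3 (λ t a b → ((con 1ℚ :- t) :* a :+ t :* b) :- con 1ℚ
                                       := (con 1ℚ :- t) :* (a :- con 1ℚ) :+ t :* (b :- con 1ℚ)) refl

-- Convex combinations of points of a set system

module _ {n} (S : SetSystem n) where

  TwoTight : (Fin n → ℚ) → Set
  TwoTight x = ∀ h → ValidGSC S h → nvars h ≡ 2 → lhs h x ≡ 1ℚ

  vertex∈conv : ∀ {v} → S v ≡ true → InConv S (vertex v)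
  vertex∈conv {v} v∈S = (1ℚ , v) ∷ [] , (ℚₚ.nonNegative⁻¹ 1ℚ , v∈S) ∷ [] , refl ,
    λ i → sym (trans (ℚₚ.+-identityʳ _) (ℚₚ.*-identityˡ _))

  InConv-resp : ∀ {x y} → (∀ i → x i ≡ y i) → InConv S x → InConv S y
  InConv-resp x≗y (L , members , total , coords) = L , members , total , λ i → trans (sym (x≗y i)) (coords i)

  module Combination {x} (x∈conv : InConv S x) where

    L : List (ℚ × Point n)
    L = proj₁ x∈conv

    nonNeg : All (λ p → 0ℚ ℚ.≤ coef p) L
    nonNeg = All.map proj₁ (proj₁ (proj₂ x∈conv))

    members : All (λ p → S (proj₂ p) ≡ true) L
    members = All.map proj₂ (proj₁ (proj₂ x∈conv))

    total : Σlist L coef ≡ 1ℚ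
    total = proj₁ (proj₂ (proj₂ x∈conv))

    coords : ∀ i → x i ≡ average L (λ p → vertex (proj₂ p) i)
    coords = proj₂ (proj₂ (proj₂ x∈conv))

    term-as-average : ∀ s i → term s (x i) ≡ average L (λ p → term s (vertex (proj₂ p) i))
    term-as-average s i =
      trans (cong (term s) (coords i)) (term-average {L = L} total s (λ p → vertex (proj₂ p) i))

    lhs-as-average : ∀ {m} (g : GSC m) (idx : Fin m → Fin n) →
      lhs g (x ∘ idx) ≡ average L (λ p → lhs g (vertex (proj₂ p) ∘ idx))
    lhs-as-average g idx = lhs-average {L = L} total g (λ p → vertex (proj₂ p) ∘ idx) (coords ∘ idx)

    tight-on-support : ∀ {g} → ValidGSC S g → lhs g x ≡ 1ℚ →
      All (λ p → Support p → lhs g (vertex (proj₂ p)) ≡ 1ℚ) L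
    tight-on-support {g} valid tight = support-tight {L = L} nonNeg total (All.map (valid _ ∘ vertex∈conv) members)
      (ℚₚ.≤-reflexive (trans (sym (lhs-as-average g (λ i → i))) tight))

    support⊆core : TwoTight x → All (λ p → Support p → InCore S (proj₂ p)) L
    support⊆core twoTight = All.tabulate λ p∈ supp → All.lookup members p∈ ,
      λ h valid two → All.lookup (tight-on-support {h} valid (twoTight h valid two)) p∈ supp

  centre : Fin n → ℚ
  centre _ = ½

  module _ {D : List (Ineq n)} (describes : Describes S D) where

    Sat⇒conv : ∀ {x} → All (Sat x) D → InConv S x
    Sat⇒conv = Equivalence.to (describes _)

    ∈D⇒valid : ∀ {g} → gsc g ∈ D → ValidGSC S g
    ∈D⇒valid g∈D x x∈conv = All.lookup (Equivalence.from (describes x) x∈conv) g∈D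

    module _ (conn : Connectivity≥2 S) where

      centre-Sat : ∀ {ι} → ι ∈ D → Sat centre ι
      centre-Sat {lower i} _   = term-½-nonNeg pos
      centre-Sat {upper i} _   = toWitness {a? = ½ ℚₚ.≤? 1ℚ} _
      centre-Sat {gsc g}   g∈D = ℚₚ.≤-trans (×-monoˡ-≤ (term-½-nonNeg pos) (conn g (∈D⇒valid g∈D)))
        (countFin·≤Σℚ (used ∘ g) _ (term-½-nonNeg ∘ g) λ k uₖ →
          ℚₚ.≤-reflexive (sym (term-½ (g k) uₖ)))

      centre∈conv : InConv S centre
      centre∈conv = Sat⇒conv (All.tabulate centre-Sat)

      centre-twoTight : TwoTight centre
      centre-twoTight h _ two with two-used h two
      ... | i , j , i≢j , uᵢ , uⱼ =
        trans (lhs-two h two i≢j uᵢ uⱼ centre) (cong₂ _+_ (term-½ (h i) uᵢ) (term-½ (h j) uⱼ))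

      core-point : ∃ (InCore S)
      core-point = let p , p∈ , supp = support-nonempty nonNeg total
                   in proj₂ p , All.lookup (support⊆core centre-twoTight) p∈ supp
        where open Combination centre∈conv

      module _ {d} {c : Fin n → Fin d} (lab : ComponentLabelling S d c) where

        private
          z : Point n
          z = proj₁ core-point

          z∈core : InCore S z
          z∈core = proj₂ core-point

        connected⇒same-label : ∀ {i j} → Connected S i j → c i ≡ c j
        connected⇒same-label = Equivalence.from (proj₂ lab _ _)

        tight-literals : ∀ {p} → InCore S p → ∀ {h} → ValidGSC S h → nvars h ≡ 2 →
          ∀ {i j} → i ≢ j → used (h i) ≡ true → used (h j) ≡ true →
          literal (h i) (lookup p i) ≡ not (literal (h j) (lookup p j))
        tight-literals {p} p∈core {h} valid two {i} {j} i≢j uᵢ uⱼ = bℚ-complementary _ _ (begin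
          bℚ (literal (h i) (lookup p i)) + bℚ (literal (h j) (lookup p j))
            ≡⟨ cong₂ _+_ (term-bℚ (h i) _ uᵢ) (term-bℚ (h j) _ uⱼ) ⟨
          term (h i) (vertex p i) + term (h j) (vertex p j)
            ≡⟨ lhs-two h two i≢j uᵢ uⱼ (vertex p) ⟨
          lhs h (vertex p)
            ≡⟨ proj₂ p∈core h valid two ⟩
          1ℚ ∎)
          where open ≡-Reasoning

        -- Points are compared with the fixed core point z through their offset z ⊕ y.
        offset : (Fin n → Bool) → Fin n → Bool
        offset y i = lookup z i xor y i

        Aligned : (Fin n → Bool) → Set
        Aligned y = ∀ {i j} → c i ≡ c j → offset y i ≡ offset y j

        literal-offset : ∀ s y i → literal s (y i) ≡ literal s (lookup z i) xor offset y i
        literal-offset s y i = trans (cong (literal s) (sym (xor-cancelˡ (lookup z i) (y i))))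
                                     (literal-xor s (lookup z i) (offset y i))

        aligned-complementary : ∀ {y} → Aligned y → ∀ {si sj i j} → c i ≡ c j →
          literal si (lookup z i) ≡ not (literal sj (lookup z j)) → literal si (y i) ≡ not (literal sj (y j))
        aligned-complementary {y} aligned {si} {sj} {i} {j} cᵢ≡cⱼ complementary = begin
          literal si (y i)                              ≡⟨ literal-offset si y i ⟩
          literal si (lookup z i) xor offset y i        ≡⟨ cong₂ _xor_ complementary (aligned cᵢ≡cⱼ) ⟩
          not (literal sj (lookup z j)) xor offset y j  ≡⟨ not-distribˡ-xor (literal sj (lookup z j)) _ ⟨
          not (literal sj (lookup z j) xor offset y j)  ≡⟨ cong not (literal-offset sj y j) ⟨
          not (literal sj (y j))                        ∎
          where open ≡-Reasoning

        aligned-equal : ∀ {y} → Aligned y → ∀ {si sj i j} → c i ≡ c j →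
          literal si (lookup z i) ≡ literal sj (lookup z j) → literal si (y i) ≡ literal sj (y j)
        aligned-equal {y} aligned {si} {sj} {i} {j} cᵢ≡cⱼ equal = begin
          literal si (y i)                              ≡⟨ literal-offset si y i ⟩
          literal si (lookup z i) xor offset y i        ≡⟨ cong₂ _xor_ equal (aligned cᵢ≡cⱼ) ⟩
          literal sj (lookup z j) xor offset y j        ≡⟨ literal-offset sj y j ⟨
          literal sj (y j)                              ∎
          where open ≡-Reasoning

        -- Along an edge of G(S) both p and z have complementary literals, which pins the offset.
        core-aligned : ∀ {p} → InCore S p → Aligned (lookup p)
        core-aligned {p} p∈core cᵢ≡cⱼ = along (Equivalence.to (proj₂ lab _ _) cᵢ≡cⱼ)
          where
          along : ∀ {i j} → Connected S i j → offset (lookup p) i ≡ offset (lookup p) j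
          along Star.ε = refl
          along {i} (Star._◅_ {j = k} (i≢k , h , valid , two , uᵢ , uₖ) path) =
            trans (xor-injectiveˡ {literal (h i) (lookup z i)} (begin
              literal (h i) (lookup z i) xor o i       ≡⟨ literal-offset (h i) (lookup p) i ⟨
              literal (h i) (lookup p i)               ≡⟨ tight-literals p∈core valid two i≢k uᵢ uₖ ⟩
              not (literal (h k) (lookup p k))         ≡⟨ cong not (literal-offset (h k) (lookup p) k) ⟩
              not (literal (h k) (lookup z k) xor o k) ≡⟨ not-distribˡ-xor (literal (h k) (lookup z k)) _ ⟩
              not (literal (h k) (lookup z k)) xor o k ≡⟨ cong (_xor o k) (tight-literals z∈core valid two i≢k uᵢ uₖ) ⟨
              literal (h i) (lookup z i) xor o k       ∎)) (along path)
            where open ≡-Reasoning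
                  o = offset (lookup p)

        representative : Fin d → Fin n
        representative C = proj₁ (proj₁ lab C)

        label-representative : ∀ C → c (representative C) ≡ C
        label-representative C = proj₂ (proj₁ lab C) refl

        signature : Point n → Vec Bool d
        signature p = tabulate λ C → offset (lookup p) (representative C)

        EqualLiteralPair : GSC n → Set
        EqualLiteralPair g = ∃₂ λ i j → i ≢ j × used (g i) ≡ true × used (g j) ≡ true × c i ≡ c j
                                      × literal (g i) (lookup z i) ≡ literal (g j) (lookup z j)

        -- At every core point such a pair has equal literals, so tightness forces both to be false.
        equalLiteralPair-untight : ∀ {g r} → ValidGSC S g → EqualLiteralPair g → InConv S r → TwoTight r →
          (∀ k → used (g k) ≡ true → 0ℚ ℚ.< term (g k) (r k)) → lhs g r ≢ 1ℚ
        equalLiteralPair-untight {g} {r} valid (i , j , i≢j , uᵢ , uⱼ , cᵢ≡cⱼ , equal) r∈conv twoTight off tight =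
          ℚₚ.<-irrefl refl (ℚₚ.<-≤-trans (off i uᵢ) (begin
            term (g i) (r i)                                    ≡⟨ term-as-average (g i) i ⟩
            average L (λ p → term (g i) (vertex (proj₂ p) i))  ≤⟨ average-≤ nonNeg total vanishes ⟩
            0ℚ                                                  ∎))
          where
          open Combination r∈conv
          open ℚₚ.≤-Reasoning
          vanishes : All (λ p → Support p → term (g i) (vertex (proj₂ p) i) ℚ.≤ 0ℚ) L
          vanishes = All.tabulate λ {p} p∈ supp → ℚₚ.≤-reflexive (trans (term-bℚ (g i) _ uᵢ) (cong bℚ
            (equal-literals⇒false g (proj₂ p) i≢j uᵢ uⱼ
              (aligned-equal (core-aligned (All.lookup cores p∈ supp)) {g i} {g j} cᵢ≡cⱼ equal)
              (ℚₚ.≤-reflexive (All.lookup (tight-on-support {g} valid tight) p∈ supp)))))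
            where cores = support⊆core twoTight

        module Softened (ε : ℚ) (0≤ε : 0ℚ ℚ.≤ ε) (ε≤1-ε : ε ℚ.≤ 1ℚ - ε)
          (rainbow-heavy : ∀ g → RainbowIn S D g → 1ℚ ℚ.≤ nvars g · ε) (v : Vec Bool d) where

          target : Fin n → Bool
          target i = lookup z i xor lookup v (c i)

          target-aligned : Aligned target
          target-aligned {i} {j} cᵢ≡cⱼ = trans (xor-cancelˡ (lookup z i) _)
            (trans (cong (lookup v) cᵢ≡cⱼ) (sym (xor-cancelˡ (lookup z j) _)))

          q : Fin n → ℚ
          q i = soften ε (target i)

          ε≤soften : ∀ b → ε ℚ.≤ soften ε b
          ε≤soften true  = ε≤1-ε
          ε≤soften false = ℚₚ.≤-refl

          soften≤1 : ∀ b → soften ε b ℚ.≤ 1ℚ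
          soften≤1 true  = 0≤-⇒≤ (subst (0ℚ ℚ.≤_) (1-[1-ε]≡ε ε) 0≤ε)
            where 1-[1-ε]≡ε : ∀ ε → ε ≡ 1ℚ - (1ℚ - ε)
                  1-[1-ε]≡ε = solve 1 (λ ε → ε := con 1ℚ :- (con 1ℚ :- ε)) refl
          soften≤1 false = ℚₚ.≤-trans ε≤1-ε (soften≤1 true)

          term-soften-nonNeg : ∀ s b → 0ℚ ℚ.≤ term s (soften ε b)
          term-soften-nonNeg pos  b = ℚₚ.≤-trans 0≤ε (ε≤soften b)
          term-soften-nonNeg neg  b = ≤⇒0≤- (soften≤1 b)
          term-soften-nonNeg none b = ℚₚ.≤-refl

          complementary-pair : ∀ (g : GSC n) {i j} → used (g i) ≡ true → used (g j) ≡ true → c i ≡ c j →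
            literal (g i) (lookup z i) ≡ not (literal (g j) (lookup z j)) →
            term (g i) (q i) + term (g j) (q j) ≡ 1ℚ
          complementary-pair g {i} {j} uᵢ uⱼ cᵢ≡cⱼ complementary = begin
            term (g i) (q i) + term (g j) (q j)
              ≡⟨ cong₂ _+_ (term-soften ε (g i) _ uᵢ) (term-soften ε (g j) _ uⱼ) ⟩
            soften ε (literal (g i) (target i)) + soften ε (literal (g j) (target j))
              ≡⟨ cong (λ b → soften ε b + soften ε (literal (g j) (target j)))
                      (aligned-complementary target-aligned {g i} {g j} cᵢ≡cⱼ complementary) ⟩
            soften ε (not (literal (g j) (target j))) + soften ε (literal (g j) (target j))
              ≡⟨ soften-complementary ε (literal (g j) (target j)) ⟩
            1ℚ ∎
            where open ≡-Reasoning

          q-twoTight : TwoTight q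
          q-twoTight h valid two with two-used h two
          ... | i , j , i≢j , uᵢ , uⱼ = trans (lhs-two h two i≢j uᵢ uⱼ q) (complementary-pair h uᵢ uⱼ
            (connected⇒same-label ((i≢j , h , valid , two , uᵢ , uⱼ) Star.◅ Star.ε))
            (tight-literals z∈core valid two i≢j uᵢ uⱼ))

          HasEqualLiteralPair : Ineq n → Set
          HasEqualLiteralPair (gsc g) = EqualLiteralPair g
          HasEqualLiteralPair _       = ⊥

          classify : ∀ {ι} → ι ∈ D → Sat q ι ⊎ HasEqualLiteralPair ι
          classify {lower i} _ = inj₁ (term-soften-nonNeg pos (target i))
          classify {upper i} _ = inj₁ (soften≤1 (target i))
          classify {gsc g} g∈D with any? (λ i → any? (λ j →
            ¬? (i ≟ j) ×-dec used (g i) Bool.≟ true ×-dec used (g j) Bool.≟ true ×-dec c i ≟ c j))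
          ... | no ¬pair = inj₁ (ℚₚ.≤-trans (rainbow-heavy g (Any.map sym g∈D , ∈D⇒valid g∈D , rainbow))
                                  (countFin·≤Σℚ (used ∘ g) _ (λ k → term-soften-nonNeg (g k) (target k))
                                    λ k uₖ → subst (ε ℚ.≤_) (sym (term-soften ε (g k) (target k) uₖ))
                                                   (ε≤soften (literal (g k) (target k)))))
            where
            rainbow : ∀ i j → used (g i) ≡ true → used (g j) ≡ true → Connected S i j → i ≡ j
            rainbow i j uᵢ uⱼ i~j with i ≟ j
            ... | yes i≡j = i≡j
            ... | no  i≢j = ⊥-elim (¬pair (i , j , i≢j , uᵢ , uⱼ , connected⇒same-label i~j))
          ... | yes (i , j , i≢j , uᵢ , uⱼ , cᵢ≡cⱼ)
            with literal (g i) (lookup z i) Bool.≟ literal (g j) (lookup z j)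
          ...   | yes equal  = inj₂ (i , j , i≢j , uᵢ , uⱼ , cᵢ≡cⱼ , equal)
          ...   | no  differ = inj₁ (ℚₚ.≤-trans
            (ℚₚ.≤-reflexive (sym (complementary-pair g {i} {j} uᵢ uⱼ cᵢ≡cⱼ (¬-not differ))))
            (Σℚ-≥-pair (λ k → term (g k) (q k)) i≢j (λ k → term-soften-nonNeg (g k) (target k))))

          segment-twoTight : ∀ t → TwoTight (segment t centre q)
          segment-twoTight t h valid two = trans (lhs-segment h t centre q)
            (trans (cong₂ (interp t) (centre-twoTight h valid two) (q-twoTight h valid two)) (interp-const t 1ℚ))

          segment-off-facets : ∀ {t} → 0ℚ ℚ.≤ t → t ℚ.< 1ℚ → ∀ s k → used s ≡ true →
            0ℚ ℚ.< term s (segment t centre q k)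
          segment-off-facets {t} 0≤t t<1 s k uₛ = subst (0ℚ ℚ.<_)
            (sym (trans (term-interp s t ½ (q k)) (cong (λ a → interp t a (term s (q k))) (term-½ s uₛ))))
            (interp-pos 0≤t t<1 (toWitness {a? = 0ℚ ℚₚ.<? ½} _) (term-soften-nonNeg s (target k)))

          -- Move from the centre towards q; the first inequality of D to become tight is violated at q,
          -- so it has an equal-literal pair, and such inequalities cannot be tight off the facets.
          q∈conv : InConv S q
          q∈conv with line-search (λ ι → slack ι centre) (λ ι → slack ι q) D
                        (All.tabulate λ {ι} ι∈ → Sat⇒slack-nonNeg ι (centre-Sat ι∈))
          ... | t , 0≤t , t≤1 , nonNeg-at-t , stop = reach stop
            where
            r∈conv : InConv S (segment t centre q)
            r∈conv = Sat⇒conv (All.map (λ {ι} 0≤slack → slack-nonNeg⇒Sat ι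
                       (subst (0ℚ ℚ.≤_) (sym (slack-segment ι t centre q)) 0≤slack)) nonNeg-at-t)

            blocked-by : t ℚ.< 1ℚ → ∀ {ι} → ι ∈ D → Sat q ι ⊎ HasEqualLiteralPair ι → slack ι q ℚ.< 0ℚ →
              slack ι (segment t centre q) ≡ 0ℚ → ⊥
            blocked-by _ {ι} _ (inj₁ sat) violated _ =
              ℚₚ.<-irrefl refl (ℚₚ.<-≤-trans violated (Sat⇒slack-nonNeg ι sat))
            blocked-by t<1 {gsc g} g∈D (inj₂ pair) _ tight =
              equalLiteralPair-untight (∈D⇒valid g∈D) pair r∈conv (segment-twoTight t)
                (λ k → segment-off-facets 0≤t t<1 (g k) k) (-≡0⇒≡ tight)

            reach : t ≡ 1ℚ ⊎ t ℚ.< 1ℚ × Any (λ ι → slack ι q ℚ.< 0ℚ × interp t (slack ι centre) (slack ι q) ≡ 0ℚ) D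
                    → InConv S q
            reach (inj₁ t≡1)          =
              InConv-resp (λ i → trans (cong (λ t → interp t ½ (q i)) t≡1) (interp-1 ½ (q i))) r∈conv
            reach (inj₂ (t<1 , some)) = let ι , ι∈ , violated , tight = find some in
              ⊥-elim (blocked-by t<1 ι∈ (classify ι∈) violated (trans (slack-segment ι t centre q) tight))

          awayFromTarget : Fin d → Sign
          awayFromTarget C = awayFrom (target (representative C))

          lhs-awayFromTarget-vertex : ∀ p →
            lhs awayFromTarget (vertex p ∘ representative) ≡ weight (zipWith _xor_ (signature p) v) · 1ℚ
          lhs-awayFromTarget-vertex p = trans
            (Σℚ-cong λ C → trans (term-awayFrom-bℚ (lookup p (representative C)) _) (cong bℚ (mismatch C)))
            (Σℚ-bℚ (zipWith _xor_ (signature p) v))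
            where
            open ≡-Reasoning
            mismatch : ∀ C → lookup p (representative C) xor target (representative C)
                             ≡ lookup (zipWith _xor_ (signature p) v) C
            mismatch C = begin
              lookup p i xor (lookup z i xor lookup v (c i))
                ≡⟨ cong (λ C′ → lookup p i xor (lookup z i xor lookup v C′)) (label-representative C) ⟩
              lookup p i xor (lookup z i xor lookup v C)
                ≡⟨ xor-swap (lookup p i) (lookup z i) (lookup v C) ⟩
              offset (lookup p) i xor lookup v C
                ≡⟨ cong (_xor lookup v C) (lookup∘tabulate _ C) ⟨
              lookup (signature p) C xor lookup v C
                ≡⟨ lookup-zipWith _xor_ C (signature p) v ⟨
              lookup (zipWith _xor_ (signature p) v) C
                ∎
              where i = representative C

          lhs-awayFromTarget-q : lhs awayFromTarget (q ∘ representative) ≡ d · ε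
          lhs-awayFromTarget-q =
            trans (Σℚ-cong λ C → term-awayFrom-soften ε (target (representative C))) (Σℚ-const d ε)

          near-core-point : ∃ λ p → InCore S p × weight (zipWith _xor_ (signature p) v) · 1ℚ ℚ.≤ d · ε
          near-core-point =
            let p , p∈ , supp , close = support-≤-average nonNeg total (ℚₚ.≤-reflexive
                  (trans (sym (lhs-as-average awayFromTarget representative)) lhs-awayFromTarget-q))
            in proj₂ p , All.lookup (support⊆core q-twoTight) p∈ supp ,
               subst (ℚ._≤ d · ε) (lhs-awayFromTarget-vertex (proj₂ p)) close
            where open Combination q∈conv

        core-covering : ∀ ε → 0ℚ ℚ.≤ ε → ε ℚ.≤ 1ℚ - ε → (∀ g → RainbowIn S D g → 1ℚ ℚ.≤ nvars g · ε) →
          (W : List (Vec Bool d)) → (∀ w → weight w · 1ℚ ℚ.≤ d · ε → w ∈ W) →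
          CoreAtLeast S (λ m → 2 ^ d ≤ m ℕ.* length W)
        core-covering ε 0≤ε ε≤1-ε heavy W close∈W =
          P , deduplicate-! _≟ₚ_ points , All.tabulate core ,
          covering-bound (λ p w → zipWith _xor_ (signature p) w) P W covers
          where
          near : (v : Vec Bool d) → ∃ λ p → InCore S p × weight (zipWith _xor_ (signature p) v) · 1ℚ ℚ.≤ d · ε
          near = Softened.near-core-point ε 0≤ε ε≤1-ε heavy
          _≟ₚ_ : (p p′ : Point n) → Dec (p ≡ p′)
          _≟ₚ_ = Vec.≡-dec Bool._≟_
          points = map (proj₁ ∘ near) (bitVectors d)
          P = deduplicate _≟ₚ_ points
          core : ∀ {p} → p ∈ P → InCore S p
          core p∈ = let v , _ , p≡ = ∈.∈-map⁻ (proj₁ ∘ near) (∈.∈-deduplicate⁻ _≟ₚ_ points p∈)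
                    in subst (InCore S) (sym p≡) (proj₁ (proj₂ (near v)))
          covers : ∀ v → ∃₂ λ p w → p ∈ P × w ∈ W × v ≡ zipWith _xor_ (signature p) w
          covers v = p , zipWith _xor_ (signature p) v ,
                     ∈.∈-deduplicate⁺ _≟ₚ_ (∈.∈-map⁺ (proj₁ ∘ near) (∈-bitVectors v)) ,
                     close∈W _ (proj₂ (proj₂ (near v))) , sym (zipWith-xor-cancelˡ (signature p) v)
            where p = proj₁ (near v)

        core-size-without-rainbow : NoRainbow S D → CoreAtLeast S (λ m → 2 ^ d ≤ m)
        core-size-without-rainbow noRainbow =
          let P , unique , cores , covering =
                core-covering 0ℚ ℚₚ.≤-refl (toWitness {a? = 0ℚ ℚₚ.≤? 1ℚ - 0ℚ} _)
                  (λ g rainbow → ⊥-elim (noRainbow g rainbow)) (replicate d false ∷ []) only-zero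
          in P , unique , cores , subst (2 ^ d ≤_) (ℕₚ.*-identityʳ (length P)) covering
          where
          only-zero : ∀ w → weight w · 1ℚ ℚ.≤ d · 0ℚ → w ∈ replicate d false ∷ []
          only-zero w close = here (weight≡0⇒replicate w
            (ℕₚ.n≤0⇒n≡0 (×1-cancel-≤ (subst (weight w · 1ℚ ℚ.≤_) (×-zeroʳ d) close))))

        core-size-with-heavy-rainbows : ∀ κ → 2 ≤ κ → (∀ g → RainbowIn S D g → κ ≤ nvars g) →
          CoreAtLeast S (EntropyBound κ d)
        core-size-with-heavy-rainbows (suc zero) (s≤s ()) _
        core-size-with-heavy-rainbows κ@(suc (suc k)) _ κ≤nvars =
          let P , unique , cores , covering = core-covering ε 0≤ε ε≤1-ε heavy (hammingBall κ d) close∈ball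
          in P , unique , cores , entropyBound-of-covering κ d (length P) (length (hammingBall κ d)) covering
                                    (hammingBall-bound (suc k) d)
          where
          0<κ : 0ℚ ℚ.< κ · 1ℚ
          0<κ = ×1-pos (suc k)
          κ≢0 : ℚ.NonZero (κ · 1ℚ)
          κ≢0 = ℚ.>-nonZero 0<κ
          ε : ℚ
          ε = (1/ (κ · 1ℚ)) {{κ≢0}}
          0≤ε : 0ℚ ℚ.≤ ε
          0≤ε = ℚₚ.nonNegative⁻¹ ε {{ℚₚ.pos⇒nonNeg ε {{ℚₚ.1/pos⇒pos (κ · 1ℚ) {{ℚ.positive 0<κ}}}}}}
          κε≡1 : κ · ε ≡ 1ℚ
          κε≡1 = trans (cong (κ ·_) (sym (ℚₚ.*-identityˡ ε)))
                       (trans (sym (×-assoc-* κ 1ℚ ε)) (ℚₚ.*-inverseʳ (κ · 1ℚ) {{κ≢0}}))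
          ε≤1-ε : ε ℚ.≤ 1ℚ - ε
          ε≤1-ε = 0≤-⇒≤ (subst (0ℚ ℚ.≤_) (halves ε)
                    (≤⇒0≤- (ℚₚ.≤-trans (×-monoˡ-≤ {2} {κ} 0≤ε (s≤s (s≤s z≤n))) (ℚₚ.≤-reflexive κε≡1))))
            where halves : ∀ ε → 1ℚ - (ε + (ε + 0ℚ)) ≡ (1ℚ - ε) - ε
                  halves = solve 1 (λ ε → con 1ℚ :- (ε :+ (ε :+ con 0ℚ)) := (con 1ℚ :- ε) :- ε) refl
          heavy : ∀ g → RainbowIn S D g → 1ℚ ℚ.≤ nvars g · ε
          heavy g rainbow = subst (ℚ._≤ nvars g · ε) κε≡1 (×-monoˡ-≤ {κ} {nvars g} 0≤ε (κ≤nvars g rainbow))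
          close∈ball : ∀ w → weight w · 1ℚ ℚ.≤ d · ε → w ∈ hammingBall κ d
          close∈ball w close = ∈-hammingBall κ w (×1-cancel-≤ (begin
            (κ ℕ.* weight w) · 1ℚ   ≡⟨ ×1-homo-* κ (weight w) ⟩
            κ · 1ℚ * (weight w · 1ℚ)       ≤⟨ ℚₚ.*-monoˡ-≤-nonNeg (κ · 1ℚ) {{ℚ.nonNegative (ℚₚ.<⇒≤ 0<κ)}} close ⟩
            κ · 1ℚ * (d · ε)               ≡⟨ ×-comm-* d (κ · 1ℚ) ε ⟩
            d · (κ · 1ℚ * ε)               ≡⟨ cong (d ·_) (ℚₚ.*-inverseʳ (κ · 1ℚ) {{κ≢0}}) ⟩
            d · 1ℚ                         ∎))
            where open ℚₚ.≤-Reasoning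

        core-size-with-rainbow : ∀ κ → IsKappa S D κ → CoreAtLeast S (EntropyBound κ d)
        core-size-with-rainbow κ ((g₀ , (_ , rainbow₀) , nvars≡κ) , κ≤nvars) =
          core-size-with-heavy-rainbows κ (subst (2 ≤_) nvars≡κ (conn g₀ (proj₁ rainbow₀))) κ≤nvars

theorem1p4 : ∀ {n} (S : SetSystem n) (D : List (Ineq n)) →
    Describes S D → Connectivity≥2 S →
    (d : ℕ) (c : Fin n → Fin d) → ComponentLabelling S d c →
    (NoRainbow S D → CoreAtLeast S (λ m → 2 ^ d ≤ m))
    × (∀ κ → IsKappa S D κ → CoreAtLeast S (EntropyBound κ d))
theorem1p4 S D describes conn d c lab =
  core-size-without-rainbow S describes conn lab , core-size-with-rainbow S describes conn lab
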